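{- Let $q$ be a prime power, let $s\ge1$, $m\ge1$ and $0\le u\le m$ be integers, and let $\mathbf{e}\in\mathbb{N}^s$. Let $C_1,\dots,C_s$ be $m\times m$ matrices over $\mathbb{F}_q$ and put $C:=(C_1^\top\mid C_2^\top\mid\cdots\mid C_s^\top)\in\mathbb{F}_q^{m\times sm}$. Let $\mathcal{C}^\perp$ be the dual space of the row space $\mathcal{C}$ of $C$. Then: (a) If $C_1,\dots,C_s$ are all nonsingular, then they generate a digital $(u,m,\mathbf{e},s)$-net over $\mathbb{F}_q$ if and only if $\delta_{m,\mathbf{e}}(\mathcal{C}^\perp)\ge m-u+1$. (b) For arbitrary $C_1,\dots,C_s$: if $\delta_{m,\mathbf{e}}(\mathcal{C}^\perp)\ge m-u+1$, then $C_1,\dots,C_s$ generate a digital $(u,m,\mathbf{e},s)$-net over $\mathbb{F}_q$; and if $C_1,\dots,C_s$ generate a digital $(u,m,\mathbf{e},s)$-net over $\mathbb{F}_q$, then $\delta_{m,\mathbf{e}}(\mathcal{C}^\perp)\ge m-u$.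
   Context: $\mathbb{N}$ denotes the positive integers. The dual space of a subspace $\mathcal{C}\subseteq\mathbb{F}_q^{sm}$ is $\{\mathbf{A}\in\mathbb{F}_q^{sm}:\mathbf{A}\cdot\mathbf{B}=0\ \forall \mathbf{B}\in\mathcal{C}\}$ with the standard dot product. For $\mathbf{a}=(a_1,\dots,a_m)\in\mathbb{F}_q^m$ and $e\in\mathbb{N}$, $v_e(\mathbf{a})=0$ if $\mathbf{a}=\mathbf{0}$ and $v_e(\mathbf{a})=\min\{m,e\lceil \max\{j:a_j\ne0\}/e\rceil\}$ otherwise. For $\mathbf{A}=(\mathbf{a}^{(1)},\dots,\mathbf{a}^{(s)})\in\mathbb{F}_q^{sm}$ with $\mathbf{a}^{(i)}\in\mathbb{F}_q^m$ and $\mathbf{e}=(e_1,\dots,e_s)$, $V_{m,\mathbf{e}}(\mathbf{A})=\sum_{i=1}^s v_{e_i}(\mathbf{a}^{(i)})$. For a linear subspace $\mathcal{N}\subseteq\mathbb{F}_q^{sm}$, $\delta_{m,\mathbf{e}}(\mathcal{N})=\min_{\mathbf{A}\in\mathcal{N}\setminus\{\mathbf{0}\}}V_{m,\mathbf{e}}(\mathbf{A})$ if $\mathcal{N}\ne\{\mathbf{0}\}$ and $sm+1$ otherwise. An elementary interval in base $b$ is $J=\prod_{i=1}^s[a_ib^{ -d_i},(a_i+1)b^{ -d_i})$ with integers $d_i\ge0$, $0\le a_i<b^{d_i}$. A set of $b^m$ points in $[0,1)^s$ is a $(u,m,\mathbf{e},s)$-net in base $b$ if every elementary interval $J$ in base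 $b$ with $\lambda_s(J)\ge b^{u-m}$ and $e_i\mid d_i$ for all $i$ contains exactly $b^m\lambda_s(J)$ points. Digital net over $\mathbb{F}_q$ with generating matrices $C_1,\dots,C_s$: with $Z_q=\{0,\dots,q-1\}$ and bijections $\eta_r:Z_q\to\mathbb{F}_q$, $\kappa_{i,j}:\mathbb{F}_q\to Z_q$, for $0\le n<q^m$ with base-$q$ digits $n_0,\dots,n_{m-1}$ set $(y^{(i)}_{n,1},\dots,y^{(i)}_{n,m})^\top=C_i(\eta_0(n_0),\dots,\eta_{m-1}(n_{m-1}))^\top$ and $x_n^{(i)}=\sum_{j=1}^m\kappa_{i,j}(y^{(i)}_{n,j})q^{ -j}$; the points $\mathbf{x}_n=(x_n^{(1)},\dots,x_n^{(s)})$, $0\le n<q^m$, form the digital net. The matrices generate a digital $(u,m,\mathbf{e},s)$-net over $\mathbb{F}_q$ if this point set is a $(u,m,\mathbf{e},s)$-net in base $q$. -}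

module Defs where

open import Level using (0ℓ)
open import Algebra.Bundles using (CommutativeRing)
open import Data.Nat as ℕ using (ℕ; zero; suc; _∸_; _^_; _≤_; _<_; _⊓_; NonZero)
open import Data.Nat.Properties using (m^n≢0)
open import Data.Nat.DivMod using (_/_; _%_; m%n<n)
open import Data.Nat.Divisibility using (_∣_)
open import Data.Nat.Primality using (Prime)
open import Data.Fin as Fin using (Fin; zero; suc; toℕ; fromℕ<)
open import Data.Fin.Properties as FinP using (all?)
open import Data.Product using (Σ; ∃; _×_; _,_; proj₁; proj₂)
open import Data.Product.Properties using ()
open import Data.Sum using (_⊎_)
open import Data.List using (List; length; filter; upTo)
open import Data.Vec.Functional using (Vector; foldr)
open import Data.Integer using (+_)
open import Data.Rational as ℚ using (ℚ)
import Data.Rational.Properties as ℚP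
open import Relation.Nullary using (¬_; Dec; yes; no)
open import Relation.Nullary.Decidable using (map′; _×-dec_)
open import Relation.Binary.PropositionalEquality as ≡ using (_≡_)
open import Function.Base using (_∘_)
open import Function.Bundles using (Bijection)

IsPrimePower : ℕ → Set
IsPrimePower q = Σ ℕ λ p → Σ ℕ λ k → Prime p × 1 ≤ k × q ≡ p ^ k

record FiniteField (q : ℕ) : Set₁ where
  field
    commRing : CommutativeRing 0ℓ 0ℓ
  open CommutativeRing commRing public
  field
    0≉1         : ¬ (0# ≈ 1#)
    inverse     : ∀ x → ¬ (x ≈ 0#) → Σ Carrier λ y → (x * y) ≈ 1#
    enumeration : Bijection (≡.setoid (Fin q)) setoid

module Theory {q : ℕ} (F : FiniteField q) where
  open FiniteField F using (Carrier; _≈_; _+_; _*_; 0#; 1#; setoid; sym; trans; enumeration; +-commutativeMonoid)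
  open import Algebra.Properties.CommutativeMonoid.Sum +-commutativeMonoid using (sum)

  Zq : Set
  Zq = Fin q

  -- q is nonzero (the carrier is inhabited by 0#)
  instance
    q-nonZero : NonZero q
    q-nonZero with Bijection.surjective enumeration 0#
    ... | x , _ = FinP.nonZeroIndex x

  _≈?_ : (x y : Carrier) → Dec (x ≈ y)
  x ≈? y with Bijection.surjective enumeration x | Bijection.surjective enumeration y
  ... | i , fi | j , fj = map′
        (λ i≡j → trans (sym (fi ≡.refl)) (trans (Bijection.cong enumeration i≡j) (fj ≡.refl)))
        (λ x≈y → Bijection.injective enumeration (trans (fi ≡.refl) (trans x≈y (sym (fj ≡.refl)))))
        (i FinP.≟ j)

  sumℕ : ∀ {n} → (Fin n → ℕ) → ℕ
  sumℕ = foldr ℕ._+_ 0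

  sumℚ : ∀ {n} → (Fin n → ℚ) → ℚ
  sumℚ = foldr ℚ._+_ ℚ.0ℚ

  prodℚ : ∀ {n} → (Fin n → ℚ) → ℚ
  prodℚ = foldr ℚ._*_ ℚ.1ℚ

  _/q^_ : ℕ → ℕ → ℚ
  a /q^ k = ℚ._/_ (+ a) (q ^ k) {{m^n≢0 q k}}

  -- vectors in F_q^m, elements of F_q^{sm} written as (a^(1),...,a^(s)),
  -- and m×m matrices (row index, column index)
  Vec : ℕ → Set
  Vec m = Fin m → Carrier

  Space : ℕ → ℕ → Set
  Space s m = Fin s → Vec m

  Mat : ℕ → Set
  Mat m = Fin m → Fin m → Carrier

  IsZero : ∀ {s m} → Space s m → Set
  IsZero A = ∀ i j → A i j ≈ 0#

  dot : ∀ {s m} → Space s m → Space s m → Carrier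
  dot A B = sum (λ i → sum (λ j → A i j * B i j))

  _·_ : ∀ {m} → Mat m → Mat m → Mat m
  (M · N) r c = sum (λ k → M r k * N k c)

  I : ∀ {m} → Mat m
  I r c with r Fin.≟ c
  ... | yes _ = 1#
  ... | no  _ = 0#

  Nonsingular : ∀ {m} → Mat m → Set
  Nonsingular M = Σ (Mat _) λ N → (∀ r c → (M · N) r c ≈ I r c) × (∀ r c → (N · M) r c ≈ I r c)

  -- C = (C_1^T | ... | C_s^T) ∈ F_q^{m × sm}: row r, block i, column j
  -- holds (C_i^T)_{r,j} = (C_i)_{j,r}
  Cmat : ∀ {s m} → (Fin s → Mat m) → Fin m → Space s m
  Cmat Cs r i j = Cs i j r

  RowSpace : ∀ {s m} → (Fin s → Mat m) → Space s m → Set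
  RowSpace {m = m} Cs B = Σ (Vec m) λ c → ∀ i j → B i j ≈ sum (λ r → c r * Cmat Cs r i j)

  Dual : ∀ {s m} → (Space s m → Set) → Space s m → Set
  Dual N A = ∀ B → N B → dot A B ≈ 0#

  -- max{ j : a_j ≠ 0 } (indices 1..m), and 0 if a = 0
  lastNZ : ∀ {m} → Vec m → ℕ
  lastNZ {zero} a = 0
  lastNZ {suc m} a with lastNZ (a ∘ suc)
  ... | suc k = suc (suc k)
  ... | zero with a zero ≈? 0#
  ...   | yes _ = 0
  ...   | no  _ = 1

  v : (e : ℕ) → .{{NonZero e}} → ∀ {m} → Vec m → ℕ
  v e {m} a with lastNZ a
  ... | zero  = 0
  ... | suc k = m ⊓ (e ℕ.* ((suc k ℕ.+ e ∸ 1) / e))   -- ⌈L/e⌉ = ⌊(L+e-1)/e⌋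

  V : ∀ {s m} (e : Fin s → ℕ) → (∀ i → NonZero (e i)) → Space s m → ℕ
  V e enz A = sumℕ (λ i → v (e i) {{enz i}} (A i))

  IsMinDist : ∀ {s m} (e : Fin s → ℕ) → (∀ i → NonZero (e i)) → (Space s m → Set) → ℕ → Set
  IsMinDist {s} {m} e enz N d =
      ((∀ A → N A → IsZero A) × d ≡ s ℕ.* m ℕ.+ 1)
    ⊎ (Σ (Space s m) (λ A → N A × ¬ IsZero A × V e enz A ≡ d)
        × (∀ A → N A → ¬ IsZero A → d ≤ V e enz A))

  δ≥ : ∀ {s m} (e : Fin s → ℕ) → (∀ i → NonZero (e i)) → (Space s m → Set) → ℕ → Set
  δ≥ e enz N k = Σ ℕ λ d → IsMinDist e enz N d × k ≤ d

  digit : ℕ → ℕ → Zq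
  digit n k = fromℕ< (m%n<n (_/_ n (q ^ k) {{m^n≢0 q k}}) q)

  module Net {s m : ℕ} (Cs : Fin s → Mat m)
             (η : Fin m → Bijection (≡.setoid Zq) setoid)          -- η_r, r = 0..m-1
             (κ : Fin s → Fin m → Bijection setoid (≡.setoid Zq))  -- κ_{i,j}, j = 1..m
             where
    digits : ℕ → Vec m
    digits n r = Bijection.to (η r) (digit n (toℕ r))

    y : Fin s → ℕ → Vec m
    y i n j = sum (λ r → Cs i j r * digits n r)

    x : Fin s → ℕ → ℚ
    x i n = sumℚ (λ j → toℕ (Bijection.to (κ i j) (y i n j)) /q^ suc (toℕ j))

    InJ : (d a : Fin s → ℕ) → ℕ → Set
    InJ d a n = ∀ i → (a i /q^ d i) ℚ.≤ x i n × x i n ℚ.< (suc (a i) /q^ d i)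

    InJ? : (d a : Fin s → ℕ) → (n : ℕ) → Dec (InJ d a n)
    InJ? d a n = all? (λ i → ((a i /q^ d i) ℚP.≤? x i n) ×-dec (x i n ℚP.<? (suc (a i) /q^ d i)))

    count : (d a : Fin s → ℕ) → ℕ
    count d a = length (filter (InJ? d a) (upTo (q ^ m)))

    vol : (d : Fin s → ℕ) → ℚ
    vol d = prodℚ (λ i → 1 /q^ d i)

  IsDigitalNet : ∀ {s m} (u : ℕ) (e : Fin s → ℕ) (Cs : Fin s → Mat m)
                 (η : Fin m → Bijection (≡.setoid Zq) setoid)
                 (κ : Fin s → Fin m → Bijection setoid (≡.setoid Zq)) → Set
  IsDigitalNet {s} {m} u e Cs η κ =
    ∀ (d a : Fin s → ℕ) → (∀ i → a i < q ^ d i) → (∀ i → e i ∣ d i)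
    → ((q ^ u) /q^ m) ℚ.≤ vol d
    → ((+ count d a) ℚ./ 1) ≡ ((+ (q ^ m)) ℚ./ 1) ℚ.* vol d
    where open Net Cs η κ

module Submission where

-- A point x_n lies in the elementary interval with sides q^-dᵢ and indices
-- aᵢ iff its digit vector solves the linear system "row j of Cᵢ applied to
-- it = tᵢⱼ" (j < dᵢ), where tᵢⱼ are the digits of aᵢ pulled back along κ.
-- If these Σ dᵢ rows are independent, Gaussian elimination shows that every
-- such interval holds q^(m - Σ dᵢ) points (solution-count); a dependency is a
-- nonzero A ∈ C^⊥ supported on the first dᵢ entries of each block, and it
-- exhibits an empty interval.  So C_1, …, C_s generate a net iff no nonzero
-- dual vector is supported on an admissible d (eᵢ ∣ dᵢ, u + Σ dᵢ ≤ m)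
-- (net⇔noDual); comparing supports with the weight V_{m,e} turns this into
-- the bounds on δ_{m,e}(C^⊥) (module Distance).

open import Defs
open import Data.Nat using (ℕ; NonZero; _<_; _≤_)
open import Data.Fin using (Fin)
open import Function.Bundles using (Bijection)
import Relation.Binary.PropositionalEquality as PE

module NatSums where

  open import Data.Nat
  open import Data.Nat.Properties
  open import Data.Fin using (Fin; zero; suc; toℕ)
  import Data.Fin.Properties as FinP
  open import Data.List using (length; filter; applyUpTo)
  open import Data.Empty using (⊥-elim)
  open import Relation.Nullary using (¬_; Dec; yes; no)
  open import Relation.Nullary.Decidable using (_×-dec_)
  open import Relation.Unary using (Pred; Decidable)
  open import Relation.Binary.PropositionalEquality
  open import Function.Base using (_∘_)
  open import Algebra.Properties.Semiring.Sum +-*-semiring public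
    using (sum; sum-cong-≗; ∑-comm; *-distribˡ-sum)

  ind : ∀ {p} {P : Set p} → Dec P → ℕ
  ind (yes _) = 1
  ind (no _)  = 0

  ind-iff : ∀ {p r} {P : Set p} {R : Set r} (d : Dec P) (e : Dec R) →
            (P → R) → (R → P) → ind d ≡ ind e
  ind-iff (yes _) (yes _) f g = refl
  ind-iff (yes p) (no ¬r) f g = ⊥-elim (¬r (f p))
  ind-iff (no ¬p) (yes r) f g = ⊥-elim (¬p (g r))
  ind-iff (no _)  (no _)  f g = refl

  ind-yes : ∀ {p} {P : Set p} (d : Dec P) → P → ind d ≡ 1
  ind-yes (yes _) _ = refl
  ind-yes (no ¬p) p = ⊥-elim (¬p p)

  ind-no : ∀ {p} {P : Set p} (d : Dec P) → ¬ P → ind d ≡ 0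
  ind-no (yes p) ¬p = ⊥-elim (¬p p)
  ind-no (no _)  _  = refl

  ind-× : ∀ {a b} {A : Set a} {B : Set b} (x : Dec A) (y : Dec B) →
          ind (x ×-dec y) ≡ ind x * ind y
  ind-× (yes _) (yes _) = refl
  ind-× (yes _) (no _)  = refl
  ind-× (no _)  (yes _) = refl
  ind-× (no _)  (no _)  = refl

  sum-const : ∀ n c → sum {n} (λ _ → c) ≡ n * c
  sum-const zero    c = refl
  sum-const (suc n) c = cong (c +_) (sum-const n c)

  sum-single : ∀ {n} (k₀ : Fin n) → sum (λ k → ind (k FinP.≟ k₀)) ≡ 1
  sum-single {suc n} zero = cong suc (begin
      sum {n} (λ k → ind (suc k FinP.≟ zero)) ≡⟨ sum-cong-≗ {n} (λ k → ind-no (suc k FinP.≟ zero) (λ ())) ⟩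
      sum {n} (λ _ → 0)                        ≡⟨ sum-const n 0 ⟩
      n * 0                                    ≡⟨ *-zeroʳ n ⟩
      0                                        ∎)
    where open ≡-Reasoning
  sum-single {suc n} (suc k₀) = trans
    (cong₂ _+_ (ind-no (zero FinP.≟ suc k₀) (λ ()))
               (sum-cong-≗ (λ k → ind-iff (suc k FinP.≟ suc k₀) (k FinP.≟ k₀) FinP.suc-injective (cong suc))))
    (sum-single k₀)

  sum-bump : ∀ {n} (k₀ : Fin n) (f g : Fin n → ℕ) →
             (∀ k → k ≢ k₀ → f k ≡ g k) → f k₀ ≡ suc (g k₀) → sum f ≡ suc (sum g)
  sum-bump {suc n} zero f g eqs e₀ = cong₂ _+_ e₀ (sum-cong-≗ (λ k → eqs (suc k) (λ ())))
  sum-bump {suc n} (suc k₀) f g eqs e₀ = trans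
    (cong₂ _+_ (eqs zero (λ ()))
               (sum-bump k₀ (f ∘ suc) (g ∘ suc) (λ k k≢ → eqs (suc k) (k≢ ∘ FinP.suc-injective)) e₀))
    (+-suc (g zero) _)

  sum-≥ : ∀ {s} (f : Fin s → ℕ) i → f i ≤ sum f
  sum-≥ f zero    = m≤m+n _ _
  sum-≥ f (suc i) = ≤-trans (sum-≥ (f ∘ suc) i) (m≤n+m _ (f zero))

  sum-mono : ∀ {s} (f g : Fin s → ℕ) → (∀ i → f i ≤ g i) → sum f ≤ sum g
  sum-mono {zero}  f g le = z≤n
  sum-mono {suc s} f g le = +-mono-≤ (le zero) (sum-mono (f ∘ suc) (g ∘ suc) (le ∘ suc))

  sum-≥₂ : ∀ {s} (f : Fin s → ℕ) {i j} → i ≢ j → f i + f j ≤ sum f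
  sum-≥₂ f {zero}  {zero}  i≢j = ⊥-elim (i≢j refl)
  sum-≥₂ f {zero}  {suc j} _   = +-monoʳ-≤ (f zero) (sum-≥ (f ∘ suc) j)
  sum-≥₂ f {suc i} {zero}  _   = ≤-trans (≤-reflexive (+-comm (f (suc i)) (f zero)))
                                          (+-monoʳ-≤ (f zero) (sum-≥ (f ∘ suc) i))
  sum-≥₂ f {suc i} {suc j} i≢j = ≤-trans (sum-≥₂ (f ∘ suc) (i≢j ∘ cong suc)) (m≤n+m _ (f zero))

  sum-others-zero : ∀ {s} (f : Fin s → ℕ) i₀ N → sum f ≤ N → N ≤ f i₀ → ∀ i → i ≢ i₀ → f i ≡ 0
  sum-others-zero f i₀ N S≤N N≤f i i≢i₀ = n≤0⇒n≡0 (+-cancelˡ-≤ (f i₀) (f i) 0 (begin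
      f i₀ + f i  ≤⟨ sum-≥₂ f (i≢i₀ ∘ sym) ⟩
      sum f       ≤⟨ S≤N ⟩
      N           ≤⟨ N≤f ⟩
      f i₀        ≡⟨ +-identityʳ (f i₀) ⟨
      f i₀ + 0    ∎))
    where open ≤-Reasoning

  Σ< : ℕ → (ℕ → ℕ) → ℕ
  Σ< zero    g = 0
  Σ< (suc n) g = g 0 + Σ< n (g ∘ suc)

  Σ<-cong : ∀ n {g h : ℕ → ℕ} → (∀ i → i < n → g i ≡ h i) → Σ< n g ≡ Σ< n h
  Σ<-cong zero    eq = refl
  Σ<-cong (suc n) eq = cong₂ _+_ (eq 0 z<s) (Σ<-cong n (λ i i<n → eq (suc i) (s<s i<n)))

  Σ<-zero : ∀ n → Σ< n (λ _ → 0) ≡ 0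
  Σ<-zero zero    = refl
  Σ<-zero (suc n) = Σ<-zero n

  Σ<-as-sum : ∀ n (g : ℕ → ℕ) → Σ< n g ≡ sum (λ (i : Fin n) → g (toℕ i))
  Σ<-as-sum zero    g = refl
  Σ<-as-sum (suc n) g = cong (g 0 +_) (Σ<-as-sum n (g ∘ suc))

  Σ<-sum-comm : ∀ N {k} (g : ℕ → Fin k → ℕ) → Σ< N (λ n → sum (g n)) ≡ sum (λ i → Σ< N (λ n → g n i))
  Σ<-sum-comm N {k} g = begin
      Σ< N (λ n → sum (g n))                          ≡⟨ Σ<-as-sum N _ ⟩
      sum (λ (n : Fin N) → sum (g (toℕ n)))           ≡⟨ ∑-comm {N} {k} (λ n → g (toℕ n)) ⟩
      sum (λ i → sum (λ (n : Fin N) → g (toℕ n) i))   ≡⟨ sum-cong-≗ {k} (λ i → Σ<-as-sum N (λ n → g n i)) ⟨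
      sum (λ i → Σ< N (λ n → g n i))                  ∎
    where open ≡-Reasoning

  length-filter : ∀ {p} {P : Pred ℕ p} (P? : Decidable P) (g : ℕ → ℕ) n →
                  length (filter P? (applyUpTo g n)) ≡ Σ< n (λ i → ind (P? (g i)))
  length-filter P? g zero = refl
  length-filter P? g (suc n) with P? (g 0)
  ... | yes _ = cong suc (length-filter P? (g ∘ suc) n)
  ... | no  _ = length-filter P? (g ∘ suc) n

  Σ<-split : ∀ a b g → Σ< (a + b) g ≡ Σ< a g + Σ< b (λ i → g (a + i))
  Σ<-split zero    b g = refl
  Σ<-split (suc a) b g = trans (cong (g 0 +_) (Σ<-split a b (g ∘ suc))) (sym (+-assoc (g 0) _ _))

  Σ<-blocks : ∀ N k g → Σ< (N * k) g ≡ Σ< N (λ n → Σ< k (λ x → g (n * k + x)))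
  Σ<-blocks zero    k g = refl
  Σ<-blocks (suc N) k g = trans (Σ<-split k (N * k) g)
    (cong (Σ< k g +_) (trans (Σ<-blocks N k (λ i → g (k + i)))
      (Σ<-cong N (λ n _ → Σ<-cong k (λ x _ → cong g (sym (+-assoc k (n * k) x)))))))

module Extend (m : ℕ) where

  open import Data.Nat using (_≤_; _<?_)
  open import Data.Fin using (toℕ; fromℕ<)
  import Data.Fin.Properties as FinP
  open import Data.Empty using (⊥-elim)
  open import Relation.Nullary using (yes; no)
  open import Relation.Binary.PropositionalEquality as ≡ using (_≡_)

  extend : (Fin m → ℕ) → ℕ → ℕ
  extend f j with j <? m
  ... | yes j<m = f (fromℕ< j<m)
  ... | no  _   = 0

  extend-toℕ : ∀ f j → extend f (toℕ j) ≡ f j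
  extend-toℕ f j with toℕ j <? m
  ... | yes j<m = ≡.cong f (FinP.fromℕ<-toℕ j j<m)
  ... | no  j≮m = ⊥-elim (j≮m (FinP.toℕ<n j))

  extend-bound : ∀ f b → (∀ j → f j < b) → ∀ j → j < m → extend f j < b
  extend-bound f b f<b j j<m with j <? m
  ... | yes j<m = f<b _
  ... | no  j≮m = ⊥-elim (j≮m j<m)

  extend-cong-below : ∀ D {f g} → D ≤ m → (∀ j → toℕ j < D → f j ≡ g j) → ∀ j → j < D → extend f j ≡ extend g j
  extend-cong-below D D≤m eq j j<D with j <? m
  ... | yes j<m = eq _ (≡.subst (_< D) (≡.sym (FinP.toℕ-fromℕ< j<m)) j<D)
  ... | no  _   = ≡.refl

module Radix (q : ℕ) .{{_ : NonZero q}} where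

  open import Data.Nat
  open import Data.Nat.Properties
  open import Data.Nat.DivMod
  open import Data.Empty using (⊥-elim)
  open import Data.Product using (_×_; _,_)
  open import Relation.Binary.PropositionalEquality
  open import Relation.Binary.Definitions using (tri<; tri≈; tri>)
  open import Function.Base using (_∘_)

  -- Powers of q are nonzero (passed explicitly: q ^ k does not determine k).
  q^≢0 : ∀ k → NonZero (q ^ k)
  q^≢0 k = m^n≢0 q k

  quotient : ∀ a {B t} .{{_ : NonZero B}} → t < B → (a * B + t) / B ≡ a
  quotient a {B} {t} t<B = begin
      (a * B + t) / B    ≡⟨ +-distrib-/ (a * B) t (subst (_< B) (sym remainders) t<B) ⟩
      a * B / B + t / B  ≡⟨ cong₂ _+_ (m*n/n≡m a B) (m<n⇒m/n≡0 t<B) ⟩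
      a + 0              ≡⟨ +-identityʳ a ⟩
      a                  ∎
    where
    open ≡-Reasoning
    remainders : a * B % B + t % B ≡ t
    remainders = cong₂ _+_ (m*n%n≡0 a B) (m<n⇒m%n≡m t<B)

  remainder : ∀ a {B t} .{{_ : NonZero B}} → t < B → (a * B + t) % B ≡ t
  remainder a {B} {t} t<B =
    trans (cong (_% B) (+-comm (a * B) t)) (trans ([m+kn]%n≡m%n t a B) (m<n⇒m%n≡m t<B))

  Digits : ℕ → (ℕ → ℕ) → Set
  Digits d z = ∀ j → j < d → z j < q

  tail-digits : ∀ {d z} → Digits (suc d) z → Digits d (z ∘ suc)
  tail-digits ds j j<d = ds (suc j) (s<s j<d)

  -- The number with base-q digits z 0 z 1 ... z (d-1), most significant first.
  horner : ℕ → (ℕ → ℕ) → ℕ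
  horner zero    z = 0
  horner (suc d) z = z 0 * q ^ d + horner d (z ∘ suc)

  horner-cong : ∀ d {z z'} → (∀ j → j < d → z j ≡ z' j) → horner d z ≡ horner d z'
  horner-cong zero    eq = refl
  horner-cong (suc d) eq =
    cong₂ _+_ (cong (_* q ^ d) (eq 0 z<s)) (horner-cong d (λ j j<d → eq (suc j) (s<s j<d)))

  horner-bound : ∀ d z → Digits d z → horner d z < q ^ d
  horner-bound zero    z _  = z<s
  horner-bound (suc d) z ds = begin-strict
      z 0 * q ^ d + horner d (z ∘ suc)  <⟨ +-monoʳ-< (z 0 * q ^ d) (horner-bound d (z ∘ suc) (tail-digits ds)) ⟩
      z 0 * q ^ d + q ^ d               ≡⟨ +-comm (z 0 * q ^ d) _ ⟩
      suc (z 0) * q ^ d                 ≤⟨ *-monoˡ-≤ (q ^ d) (ds 0 z<s) ⟩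
      q * q ^ d                         ∎
    where open ≤-Reasoning

  horner-split : ∀ d r z → horner (d + r) z ≡ horner d z * q ^ r + horner r (λ j → z (d + j))
  horner-split zero    r z = refl
  horner-split (suc d) r z = begin
      z 0 * q ^ (d + r) + horner (d + r) (z ∘ suc)
        ≡⟨ cong₂ _+_ (cong (z 0 *_) (^-distribˡ-+-* q d r)) (horner-split d r (z ∘ suc)) ⟩
      z 0 * (q ^ d * q ^ r) + (horner d (z ∘ suc) * q ^ r + rest)
        ≡⟨ sym (+-assoc (z 0 * (q ^ d * q ^ r)) _ rest) ⟩
      z 0 * (q ^ d * q ^ r) + horner d (z ∘ suc) * q ^ r + rest
        ≡⟨ cong (λ w → w + horner d (z ∘ suc) * q ^ r + rest) (sym (*-assoc (z 0) (q ^ d) (q ^ r))) ⟩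
      z 0 * q ^ d * q ^ r + horner d (z ∘ suc) * q ^ r + rest
        ≡⟨ cong (_+ rest) (sym (*-distribʳ-+ (q ^ r) (z 0 * q ^ d) _)) ⟩
      (z 0 * q ^ d + horner d (z ∘ suc)) * q ^ r + rest
        ∎
    where
    open ≡-Reasoning
    rest = horner r (λ j → z (suc d + j))

  _quot_ : ℕ → ℕ → ℕ
  a quot k = _/_ a (q ^ k) {{q^≢0 k}}

  _rem_ : ℕ → ℕ → ℕ
  a rem k = _%_ a (q ^ k) {{q^≢0 k}}

  digitOf : ℕ → ℕ → ℕ → ℕ
  digitOf zero    a j       = 0
  digitOf (suc d) a zero    = a quot d
  digitOf (suc d) a (suc j) = digitOf d (a rem d) j

  digitOf-digits : ∀ d a → a < q ^ d → Digits d (digitOf d a)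
  digitOf-digits (suc d) a a< zero    _         = m<n*o⇒m/o<n {{q^≢0 d}} a<
  digitOf-digits (suc d) a a< (suc j) (s<s j<d) = digitOf-digits d _ (m%n<n a (q ^ d) {{q^≢0 d}}) j j<d

  horner-digitOf : ∀ d a → a < q ^ d → horner d (digitOf d a) ≡ a
  horner-digitOf zero    zero    _  = refl
  horner-digitOf zero    (suc a) (s<s ())
  horner-digitOf (suc d) a       a< = begin
      a quot d * q ^ d + horner d (digitOf d (a rem d))
        ≡⟨ cong (a quot d * q ^ d +_) (horner-digitOf d _ (m%n<n a (q ^ d) {{q^≢0 d}})) ⟩
      a quot d * q ^ d + a rem d
        ≡⟨ +-comm _ (a rem d) ⟩
      a rem d + a quot d * q ^ d
        ≡⟨ sym (m≡m%n+[m/n]*n a (q ^ d) {{q^≢0 d}}) ⟩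
      a ∎
    where open ≡-Reasoning

  digitOf-horner : ∀ d z → Digits d z → ∀ j → j < d → digitOf d (horner d z) j ≡ z j
  digitOf-horner (suc d) z ds zero _ = quotient (z 0) {{q^≢0 d}} (horner-bound d (z ∘ suc) (tail-digits ds))
  digitOf-horner (suc d) z ds (suc j) (s<s j<d) = begin
      digitOf d ((z 0 * q ^ d + horner d (z ∘ suc)) rem d) j
        ≡⟨ cong (λ w → digitOf d w j) (remainder (z 0) {{q^≢0 d}} (horner-bound d (z ∘ suc) (tail-digits ds))) ⟩
      digitOf d (horner d (z ∘ suc)) j
        ≡⟨ digitOf-horner d (z ∘ suc) (tail-digits ds) j j<d ⟩
      z (suc j) ∎
    where open ≡-Reasoning

  horner-injective : ∀ d z z' → Digits d z → Digits d z' → horner d z ≡ horner d z' →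
                     ∀ j → j < d → z j ≡ z' j
  horner-injective d z z' ds ds' eq j j<d =
    trans (sym (digitOf-horner d z ds j j<d))
          (trans (cong (λ w → digitOf d w j) eq) (digitOf-horner d z' ds' j j<d))

  block⇒quotient : ∀ a h t B → t < B → a * B ≤ h * B + t → h * B + t < suc a * B → h ≡ a
  block⇒quotient a h t B t<B lo hi with <-cmp h a
  ... | tri≈ _ h≡a _ = h≡a
  ... | tri< h<a _ _ = ⊥-elim (<-irrefl refl (≤-<-trans lo (<-≤-trans (+-monoʳ-< (h * B) t<B)
                         (≤-trans (≤-reflexive (+-comm (h * B) B)) (*-monoˡ-≤ B h<a)))))
  ... | tri> _ _ a<h = ⊥-elim (<-irrefl refl (<-≤-trans hi (≤-trans (*-monoˡ-≤ B a<h) (m≤m+n (h * B) t))))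

  quotient⇒block : ∀ a t B → t < B → a * B ≤ a * B + t × a * B + t < suc a * B
  quotient⇒block a t B t<B =
    m≤m+n (a * B) t , ≤-trans (≤-reflexive (cong suc (+-comm (a * B) t))) (+-monoˡ-≤ (a * B) t<B)

module Fractions where

  open import Data.Nat as ℕ using (ℕ; suc; NonZero; _≤_; _<_)
  import Data.Nat.Properties as ℕP
  open import Data.Integer as ℤ using (+_; +≤+; +<+)
  import Data.Integer.Properties as ℤP
  open import Data.Rational as ℚ using (ℚ; toℚᵘ)
  import Data.Rational.Properties as ℚP
  open import Data.Rational.Unnormalised as ℚᵘ using (mkℚᵘ; *≡*; *≤*; *<*)
  import Data.Rational.Unnormalised.Properties as ℚᵘP
  open import Relation.Binary.PropositionalEquality

  pos-distrib : ∀ a b → + a ℤ.* + b ≡ + (a ℕ.* b)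
  pos-distrib a b = sym (ℤP.pos-* a b)

  frac : ℕ → (B : ℕ) → .{{NonZero B}} → ℚ
  frac a B = (+ a) ℚ./ B

  -- a / (B' + 1) as an unnormalised rational; comparisons and arithmetic
  -- of fractions reduce to cross-multiplied natural numbers.
  toℚᵘ-frac : ∀ a B' → toℚᵘ (frac a (suc B')) ℚᵘ.≃ mkℚᵘ (+ a) B'
  toℚᵘ-frac a B' = ℚP.toℚᵘ-fromℚᵘ (mkℚᵘ (+ a) B')

  frac-≤ : ∀ a B b C .{{_ : NonZero B}} .{{_ : NonZero C}} → frac a B ℚ.≤ frac b C → a ℕ.* C ≤ b ℕ.* B
  frac-≤ a (suc B') b (suc C') le
    with ℚᵘP.≤-respʳ-≃ (toℚᵘ-frac b C') (ℚᵘP.≤-respˡ-≃ (toℚᵘ-frac a B') (ℚP.toℚᵘ-mono-≤ le))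
  ... | *≤* h = ℤP.drop‿+≤+ (subst₂ ℤ._≤_ (pos-distrib a (suc C')) (pos-distrib b (suc B')) h)

  ≤-frac : ∀ a B b C .{{_ : NonZero B}} .{{_ : NonZero C}} → a ℕ.* C ≤ b ℕ.* B → frac a B ℚ.≤ frac b C
  ≤-frac a (suc B') b (suc C') h = ℚP.toℚᵘ-cancel-≤
    (ℚᵘP.≤-respʳ-≃ (ℚᵘP.≃-sym (toℚᵘ-frac b C')) (ℚᵘP.≤-respˡ-≃ (ℚᵘP.≃-sym (toℚᵘ-frac a B'))
      (*≤* (subst₂ ℤ._≤_ (sym (pos-distrib a (suc C'))) (sym (pos-distrib b (suc B'))) (+≤+ h)))))

  frac-< : ∀ a B b C .{{_ : NonZero B}} .{{_ : NonZero C}} → frac a B ℚ.< frac b C → a ℕ.* C < b ℕ.* B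
  frac-< a (suc B') b (suc C') lt
    with ℚᵘP.<-respʳ-≃ (toℚᵘ-frac b C') (ℚᵘP.<-respˡ-≃ (toℚᵘ-frac a B') (ℚP.toℚᵘ-mono-< lt))
  ... | *<* h = ℤP.drop‿+<+ (subst₂ ℤ._<_ (pos-distrib a (suc C')) (pos-distrib b (suc B')) h)

  <-frac : ∀ a B b C .{{_ : NonZero B}} .{{_ : NonZero C}} → a ℕ.* C < b ℕ.* B → frac a B ℚ.< frac b C
  <-frac a (suc B') b (suc C') h = ℚP.toℚᵘ-cancel-<
    (ℚᵘP.<-respʳ-≃ (ℚᵘP.≃-sym (toℚᵘ-frac b C')) (ℚᵘP.<-respˡ-≃ (ℚᵘP.≃-sym (toℚᵘ-frac a B'))
      (*<* (subst₂ ℤ._<_ (sym (pos-distrib a (suc C'))) (sym (pos-distrib b (suc B'))) (+<+ h)))))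

  frac-≡ : ∀ a B b C .{{_ : NonZero B}} .{{_ : NonZero C}} → frac a B ≡ frac b C → a ℕ.* C ≡ b ℕ.* B
  frac-≡ a (suc B') b (suc C') eq
    with ℚᵘP.≃-trans (ℚᵘP.≃-sym (toℚᵘ-frac a B')) (ℚᵘP.≃-trans (ℚP.toℚᵘ-cong eq) (toℚᵘ-frac b C'))
  ... | *≡* h = ℤP.+-injective (trans (sym (pos-distrib a (suc C'))) (trans h (pos-distrib b (suc B'))))

  ≡-frac : ∀ a B b C .{{_ : NonZero B}} .{{_ : NonZero C}} → a ℕ.* C ≡ b ℕ.* B → frac a B ≡ frac b C
  ≡-frac a (suc B') b (suc C') h = ℚP.toℚᵘ-injective (ℚᵘP.≃-trans (toℚᵘ-frac a B') (ℚᵘP.≃-trans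
    (*≡* (trans (pos-distrib a (suc C')) (trans (cong +_ h) (sym (pos-distrib b (suc B'))))))
    (ℚᵘP.≃-sym (toℚᵘ-frac b C'))))

  frac-+ : ∀ a B b D .{{_ : NonZero B}} .{{_ : NonZero D}} →
           frac a B ℚ.+ frac b D ≡ frac (a ℕ.* D ℕ.+ b ℕ.* B) (B ℕ.* D) {{ℕP.m*n≢0 B D}}
  frac-+ a (suc B') b (suc D') = ℚP.toℚᵘ-injective
    (ℚᵘP.≃-trans (ℚP.toℚᵘ-homo-+ (frac a (suc B')) (frac b (suc D')))
    (ℚᵘP.≃-trans (ℚᵘP.+-cong (toℚᵘ-frac a B') (toℚᵘ-frac b D'))
    (ℚᵘP.≃-trans (*≡* (cong (ℤ._* ℚᵘ.↧ (mkℚᵘ (+ a) B' ℚᵘ.+ mkℚᵘ (+ b) D')) numerator))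
                 (ℚᵘP.≃-sym (toℚᵘ-frac (a ℕ.* suc D' ℕ.+ b ℕ.* suc B') (D' ℕ.+ B' ℕ.* suc D'))))))
    where
    numerator : + a ℤ.* + suc D' ℤ.+ + b ℤ.* + suc B' ≡ + (a ℕ.* suc D' ℕ.+ b ℕ.* suc B')
    numerator = trans (cong₂ ℤ._+_ (pos-distrib a (suc D')) (pos-distrib b (suc B')))
                      (sym (ℤP.pos-+ (a ℕ.* suc D') _))

  frac-* : ∀ a B b C .{{_ : NonZero B}} .{{_ : NonZero C}} →
           frac a B ℚ.* frac b C ≡ frac (a ℕ.* b) (B ℕ.* C) {{ℕP.m*n≢0 B C}}
  frac-* a (suc B') b (suc C') = ℚP.toℚᵘ-injective
    (ℚᵘP.≃-trans (ℚP.toℚᵘ-homo-* (frac a (suc B')) (frac b (suc C')))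
    (ℚᵘP.≃-trans (ℚᵘP.*-cong (toℚᵘ-frac a B') (toℚᵘ-frac b C'))
    (ℚᵘP.≃-trans (*≡* (cong (ℤ._* ℚᵘ.↧ (mkℚᵘ (+ a) B' ℚᵘ.* mkℚᵘ (+ b) C')) (pos-distrib a b)))
                 (ℚᵘP.≃-sym (toℚᵘ-frac (a ℕ.* b) (C' ℕ.+ B' ℕ.* suc C'))))))

module QAdic {q : ℕ} (F : FiniteField q) where

  open import Data.Nat as ℕ using (zero; suc; _+_; _*_; _^_; _≤_; _<_)
  import Data.Nat.Properties as ℕP
  open import Data.Fin using (Fin; toℕ)
  import Data.Fin as Fin
  open import Data.Integer using (+_)
  import Data.Rational as ℚ
  import Data.Rational.Properties as ℚP
  open import Data.Product using (_×_; _,_)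
  open import Function.Base using (_∘_)
  open import Function.Bundles using (_⇔_; mk⇔; Equivalence)
  open import Relation.Binary.PropositionalEquality
  open Theory F using (q-nonZero; _/q^_; sumℚ; prodℚ)
  open Radix q
  open Fractions
  open NatSums using (sum)
  open Equivalence using (to; from)

  shift : ∀ a k r → a * q ^ (k + r) ≡ a * q ^ r * q ^ k
  shift a k r = begin
      a * q ^ (k + r)      ≡⟨ cong (a *_) (ℕP.^-distribˡ-+-* q k r) ⟩
      a * (q ^ k * q ^ r)  ≡⟨ cong (a *_) (ℕP.*-comm (q ^ k) (q ^ r)) ⟩
      a * (q ^ r * q ^ k)  ≡⟨ ℕP.*-assoc a (q ^ r) (q ^ k) ⟨
      a * q ^ r * q ^ k    ∎
    where open ≡-Reasoning

  /q^-scale : ∀ a k r → a /q^ k ≡ (a * q ^ r) /q^ (k + r)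
  /q^-scale a k r = ≡-frac a (q ^ k) (a * q ^ r) (q ^ (k + r)) {{q^≢0 k}} {{q^≢0 (k + r)}} (shift a k r)

  /q^-+ : ∀ a b k → a /q^ k ℚ.+ b /q^ k ≡ (a + b) /q^ k
  /q^-+ a b k = trans (frac-+ a B b B {{q^≢0 k}} {{q^≢0 k}})
                      (≡-frac (a * B + b * B) (B * B) (a + b) B {{ℕP.m*n≢0 B B {{q^≢0 k}} {{q^≢0 k}}}} {{q^≢0 k}} (begin
      (a * B + b * B) * B  ≡⟨ cong (_* B) (ℕP.*-distribʳ-+ B a b) ⟨
      (a + b) * B * B      ≡⟨ ℕP.*-assoc (a + b) B B ⟩
      (a + b) * (B * B)    ∎))
    where
    open ≡-Reasoning
    B = q ^ k

  /q^-* : ∀ a b → 1 /q^ a ℚ.* 1 /q^ b ≡ 1 /q^ (a + b)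
  /q^-* a b = trans (frac-* 1 (q ^ a) 1 (q ^ b) {{q^≢0 a}} {{q^≢0 b}})
                    (≡-frac 1 (q ^ a * q ^ b) 1 (q ^ (a + b)) {{ℕP.m*n≢0 (q ^ a) (q ^ b) {{q^≢0 a}} {{q^≢0 b}}}} {{q^≢0 (a + b)}}
                      (trans (ℕP.*-identityˡ _) (trans (ℕP.^-distribˡ-+-* q a b) (sym (ℕP.*-identityˡ _)))))

  sumℚ-cong : ∀ {n} {f g : Fin n → ℚ.ℚ} → (∀ j → f j ≡ g j) → sumℚ f ≡ sumℚ g
  sumℚ-cong {zero}  eq = refl
  sumℚ-cong {suc n} eq = cong₂ ℚ._+_ (eq Fin.zero) (sumℚ-cong (eq ∘ Fin.suc))

  radix-sum : ∀ m (z : ℕ → ℕ) k →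
              sumℚ {m} (λ j → z (toℕ j) /q^ (k + suc (toℕ j))) ≡ horner m z /q^ (k + m)
  radix-sum zero    z k = sym (ℚP.0/n≡0 (q ^ (k + 0)) {{q^≢0 (k + 0)}})
  radix-sum (suc m) z k = begin
      z 0 /q^ (k + 1) ℚ.+ sumℚ {m} (λ j → z (suc (toℕ j)) /q^ (k + suc (suc (toℕ j))))
        ≡⟨ cong₂ ℚ._+_ (cong (z 0 /q^_) (ℕP.+-comm k 1))
                       (trans (sumℚ-cong {m} (λ j → cong (z (suc (toℕ j)) /q^_) (ℕP.+-suc k (suc (toℕ j)))))
                              (radix-sum m (z ∘ suc) (suc k))) ⟩
      z 0 /q^ suc k ℚ.+ horner m (z ∘ suc) /q^ (suc k + m)
        ≡⟨ cong (ℚ._+ horner m (z ∘ suc) /q^ (suc k + m)) (/q^-scale (z 0) (suc k) m) ⟩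
      (z 0 * q ^ m) /q^ (suc k + m) ℚ.+ horner m (z ∘ suc) /q^ (suc k + m)
        ≡⟨ /q^-+ (z 0 * q ^ m) _ (suc k + m) ⟩
      horner (suc m) z /q^ (suc k + m)
        ≡⟨ cong (horner (suc m) z /q^_) (ℕP.+-suc k m) ⟨
      horner (suc m) z /q^ (k + suc m) ∎
    where open ≡-Reasoning

  lower-bound⇔ : ∀ a X d e → (a /q^ d ℚ.≤ X /q^ (d + e)) ⇔ (a * q ^ e ≤ X)
  lower-bound⇔ a X d e = mk⇔
    (λ le → ℕP.*-cancelʳ-≤ (a * q ^ e) X (q ^ d) {{q^≢0 d}}
              (subst (_≤ X * q ^ d) (shift a d e) (frac-≤ a (q ^ d) X (q ^ (d + e)) {{q^≢0 d}} {{q^≢0 (d + e)}} le)))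
    (λ le → ≤-frac a (q ^ d) X (q ^ (d + e)) {{q^≢0 d}} {{q^≢0 (d + e)}}
              (subst (_≤ X * q ^ d) (sym (shift a d e)) (ℕP.*-monoˡ-≤ (q ^ d) le)))

  upper-bound⇔ : ∀ X b d e → (X /q^ (d + e) ℚ.< b /q^ d) ⇔ (X < b * q ^ e)
  upper-bound⇔ X b d e = mk⇔
    (λ lt → ℕP.*-cancelʳ-< (q ^ d) X (b * q ^ e)
              (subst (X * q ^ d <_) (shift b d e) (frac-< X (q ^ (d + e)) b (q ^ d) {{q^≢0 (d + e)}} {{q^≢0 d}} lt)))
    (λ lt → <-frac X (q ^ (d + e)) b (q ^ d) {{q^≢0 (d + e)}} {{q^≢0 d}}
              (subst (X * q ^ d <_) (sym (shift b d e)) (ℕP.*-monoˡ-< (q ^ d) {{q^≢0 d}} lt)))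

  inBlock⇔prefix : ∀ m d z a → d ≤ m → Digits m z →
    (a /q^ d ℚ.≤ horner m z /q^ m × horner m z /q^ m ℚ.< suc a /q^ d) ⇔ (horner d z ≡ a)
  inBlock⇔prefix m d z a d≤m ds with ℕP.m≤n⇒∃[o]m+o≡n d≤m
  ... | e , refl = mk⇔
    (λ (lo , hi) → block⇒quotient a h t (q ^ e) t<
                     (subst (a * q ^ e ≤_) split (to (lower-bound⇔ a X d e) lo))
                     (subst (_< suc a * q ^ e) split (to (upper-bound⇔ X (suc a) d e) hi)))
    (λ { refl → let (lo , hi) = quotient⇒block h t (q ^ e) t< in
                  from (lower-bound⇔ h X d e) (subst (h * q ^ e ≤_) (sym split) lo)
                , from (upper-bound⇔ X (suc h) d e) (subst (_< suc h * q ^ e) (sym split) hi) })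
    where
    X = horner (d + e) z
    h = horner d z
    t = horner e (λ j → z (d + j))
    split : X ≡ h * q ^ e + t
    split = horner-split d e z
    t< : t < q ^ e
    t< = horner-bound e _ (λ j j<e → ds (d + j) (ℕP.+-monoʳ-< d j<e))

  volume : ∀ {s} (d : Fin s → ℕ) → prodℚ (λ i → 1 /q^ d i) ≡ 1 /q^ sum d
  volume {zero}  d = refl
  volume {suc s} d = trans (cong (1 /q^ d Fin.zero ℚ.*_) (volume (d ∘ Fin.suc))) (/q^-* (d Fin.zero) _)

  count-equation⇔ : ∀ c m D → ((+ c) ℚ./ 1 ≡ ((+ (q ^ m)) ℚ./ 1) ℚ.* (1 /q^ D)) ⇔ (c * q ^ D ≡ q ^ m)
  count-equation⇔ c m D = mk⇔
    (λ eq → trans (cong (c *_) (sym (ℕP.*-identityˡ (q ^ D))))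
              (trans (frac-≡ c 1 (q ^ m * 1) (1 * q ^ D) {{_}} {{nz}} (trans eq rhs)) (units (q ^ m))))
    (λ eq → trans (≡-frac c 1 (q ^ m * 1) (1 * q ^ D) {{_}} {{nz}}
                    (trans (cong (c *_) (ℕP.*-identityˡ (q ^ D))) (trans eq (sym (units (q ^ m))))))
                  (sym rhs))
    where
    nz = ℕP.m*n≢0 1 (q ^ D) {{_}} {{q^≢0 D}}
    rhs : ((+ (q ^ m)) ℚ./ 1) ℚ.* (1 /q^ D) ≡ frac (q ^ m * 1) (1 * q ^ D) {{nz}}
    rhs = frac-* (q ^ m) 1 1 (q ^ D) {{_}} {{q^≢0 D}}
    units : ∀ n → n * 1 * 1 ≡ n
    units n = trans (ℕP.*-identityʳ (n * 1)) (ℕP.*-identityʳ n)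

  volume-bound⇔ : 1 < q → ∀ u m D → ((q ^ u) /q^ m ℚ.≤ 1 /q^ D) ⇔ (u + D ≤ m)
  volume-bound⇔ 1<q u m D = mk⇔
    (λ le → ℕP.≮⇒≥ (λ m<u+D → ℕP.<⇒≱ (ℕP.^-monoʳ-< q 1<q m<u+D)
              (subst₂ _≤_ powers (ℕP.*-identityˡ _) (frac-≤ (q ^ u) (q ^ m) 1 (q ^ D) {{q^≢0 m}} {{q^≢0 D}} le))))
    (λ le → ≤-frac (q ^ u) (q ^ m) 1 (q ^ D) {{q^≢0 m}} {{q^≢0 D}}
              (subst₂ _≤_ (sym powers) (sym (ℕP.*-identityˡ _)) (ℕP.^-monoʳ-≤ q le)))
    where
    powers : q ^ u * q ^ D ≡ q ^ (u + D)
    powers = sym (ℕP.^-distribˡ-+-* q u D)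

module Weight where

  open import Data.Nat
  open import Data.Nat.Properties
  open import Data.Nat.DivMod
  open import Data.Nat.Divisibility using (_∣_; divides)
  open import Data.Empty using (⊥-elim)
  open import Data.Product using (_×_; _,_)
  open import Relation.Nullary using (yes; no)
  open import Relation.Binary.PropositionalEquality

  -- e * ⌈L / e⌉, computed as e * ⌊(L + e - 1) / e⌋.
  roundUp : (e : ℕ) → .{{NonZero e}} → ℕ → ℕ
  roundUp e L = e * ((L + e ∸ 1) / e)

  roundUp-≥ : ∀ e .{{_ : NonZero e}} L → L ≤ roundUp e L
  roundUp-≥ e@(suc e') L = +-cancelʳ-≤ e' L (roundUp e L) (begin
      L + e'               ≡⟨ cong (_∸ 1) (+-suc L e') ⟨
      X                    ≡⟨ m≡m%n+[m/n]*n X e ⟩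
      X % e + c * e        ≤⟨ +-monoˡ-≤ (c * e) (s≤s⁻¹ (m%n<n X e)) ⟩
      e' + c * e           ≡⟨ +-comm e' (c * e) ⟩
      c * e + e'           ≡⟨ cong (_+ e') (*-comm c e) ⟩
      e * c + e'           ∎)
    where
    open ≤-Reasoning
    X = L + e ∸ 1
    c = X / e

  roundUp-least : ∀ e .{{_ : NonZero e}} L d → e ∣ d → L ≤ d → roundUp e L ≤ d
  roundUp-least e@(suc e') L d (divides t refl) L≤d = begin
      e * c      ≤⟨ *-monoʳ-≤ e c≤t ⟩
      e * t      ≡⟨ *-comm e t ⟩
      t * e      ∎
    where
    open ≤-Reasoning
    X = L + e ∸ 1
    c = X / e
    X<[1+t]e : X < suc t * e
    X<[1+t]e = begin-strict
      X              ≡⟨ cong (_∸ 1) (+-suc L e') ⟩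
      L + e'         ≤⟨ +-monoˡ-≤ e' L≤d ⟩
      t * e + e'     <⟨ +-monoʳ-< (t * e) (n<1+n e') ⟩
      t * e + e      ≡⟨ +-comm (t * e) e ⟩
      suc t * e      ∎
    c≤t : c ≤ t
    c≤t = s≤s⁻¹ (m<n*o⇒m/o<n X<[1+t]e)

  -- v_e(a) for a vector of length m whose last nonzero entry is at
  -- position L (L = 0 for the zero vector).
  weight : (e : ℕ) → .{{NonZero e}} → ℕ → ℕ → ℕ
  weight e m zero    = 0
  weight e m (suc k) = m ⊓ roundUp e (suc k)

  weight-pos : ∀ e .{{_ : NonZero e}} m k → 1 ≤ m → 1 ≤ weight e m (suc k)
  weight-pos e m k 1≤m = ⊓-pres-m< 1≤m (≤-trans (s≤s z≤n) (roundUp-≥ e (suc k)))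

  weight<m : ∀ e .{{_ : NonZero e}} m L → weight e m L < m → e ∣ weight e m L × L ≤ weight e m L
  weight<m e m zero    _ = divides 0 refl , z≤n
  weight<m e m (suc k) lt with m ≤? roundUp e (suc k)
  ... | yes m≤r = ⊥-elim (<-irrefl (m≤n⇒m⊓n≡m m≤r) lt)
  ... | no  m≰r = subst (λ w → e ∣ w × suc k ≤ w) (sym (m≥n⇒m⊓n≡n (<⇒≤ (≰⇒> m≰r))))
                        (divides ((suc k + e ∸ 1) / e) (*-comm e _) , roundUp-≥ e (suc k))

  weight-least : ∀ e .{{_ : NonZero e}} m L d → e ∣ d → L ≤ d → weight e m L ≤ d
  weight-least e m zero    d _   _   = z≤n
  weight-least e m (suc k) d e∣d L≤d = ≤-trans (m⊓n≤n m _) (roundUp-least e (suc k) d e∣d L≤d)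

module FieldSums {q : ℕ} (F : FiniteField q) where

  open FiniteField F hiding (zero)
  open Theory F using (Vec; I)
  open import Data.Nat as ℕ using (zero; suc)
  open import Data.Fin using (Fin; zero; suc)
  import Data.Fin as Fin
  import Data.Fin.Properties as FinP
  open import Data.Empty using (⊥-elim)
  open import Relation.Nullary using (yes; no)
  open import Relation.Binary.PropositionalEquality as ≡ using (_≢_)
  open import Function.Base using (_∘_)
  open import Algebra.Properties.Semiring.Sum semiring public
    using (sum; sum-cong-≋; ∑-distrib-+; ∑-comm; *-distribˡ-sum; *-distribʳ-sum)
  open import Algebra.Properties.CommutativeMonoid.Sum +-commutativeMonoid using (sum-replicate-zero)
  open import Relation.Binary.Reasoning.Setoid setoid

  sum-zero : ∀ {n} {f : Fin n → Carrier} → (∀ k → f k ≈ 0#) → sum f ≈ 0#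
  sum-zero {n} eq = trans (sum-cong-≋ eq) (sum-replicate-zero n)

  sum-at : ∀ {n} (f : Fin n → Carrier) k₀ → (∀ k → k ≢ k₀ → f k ≈ 0#) → sum f ≈ f k₀
  sum-at f zero     off = trans (+-congˡ (sum-zero (λ k → off (suc k) (λ ())))) (+-identityʳ _)
  sum-at f (suc k₀) off = trans (+-congʳ (off zero (λ ()))) (trans (+-identityˡ _)
                            (sum-at (f ∘ suc) k₀ (λ k k≢k₀ → off (suc k) (k≢k₀ ∘ FinP.suc-injective))))

  I-diagonal : ∀ {m} (r : Fin m) → I r r ≈ 1#
  I-diagonal r with r Fin.≟ r
  ... | yes _   = refl
  ... | no  r≢r = ⊥-elim (r≢r ≡.refl)

  I-offDiagonal : ∀ {m} (r c : Fin m) → r ≢ c → I r c ≈ 0#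
  I-offDiagonal r c r≢c with r Fin.≟ c
  ... | yes r≡c = ⊥-elim (r≢c r≡c)
  ... | no  _   = refl

  sum-I : ∀ {m} (f : Fin m → Carrier) r₀ → sum (λ r → f r * I r r₀) ≈ f r₀
  sum-I f r₀ = begin
      sum (λ r → f r * I r r₀)  ≈⟨ sum-at _ r₀ (λ r r≢r₀ → trans (*-congˡ (I-offDiagonal r r₀ r≢r₀)) (zeroʳ _)) ⟩
      f r₀ * I r₀ r₀            ≈⟨ *-congˡ (I-diagonal r₀) ⟩
      f r₀ * 1#                 ≈⟨ *-identityʳ _ ⟩
      f r₀                      ∎

  sum-neg : ∀ {n} (f : Fin n → Carrier) → sum (λ k → - f k) ≈ - sum f
  sum-neg {zero}  f = sym (trans (sym (+-identityʳ (- 0#))) (-‿inverseˡ 0#))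
  sum-neg {suc n} f = trans (+-congˡ (sum-neg (f ∘ suc))) (⁻¹-∙-comm (f zero) (sum (f ∘ suc)))
    where open import Algebra.Properties.AbelianGroup +-abelianGroup using (⁻¹-∙-comm)

  dotv : ∀ {n} → Vec n → Vec n → Carrier
  dotv r c = sum (λ k → r k * c k)

  dotv-linear : ∀ {n} (a b c : Vec n) β → dotv (λ k → a k - β * b k) c ≈ dotv a c - β * dotv b c
  dotv-linear {n} a b c β = begin
      sum (λ k → (a k - β * b k) * c k)
        ≈⟨ sum-cong-≋ {n} (λ k → trans (distribʳ (c k) (a k) _)
                               (+-congˡ (trans (sym (-‿distribˡ-* _ _)) (-‿cong (*-assoc β (b k) (c k)))))) ⟩
      sum (λ k → a k * c k + - (β * (b k * c k)))
        ≈⟨ ∑-distrib-+ {n} _ _ ⟩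
      dotv a c + sum (λ k → - (β * (b k * c k)))
        ≈⟨ +-congˡ (trans (sum-neg {n} _) (-‿cong (sym (*-distribˡ-sum β (λ k → b k * c k))))) ⟩
      dotv a c - β * dotv b c ∎
    where open import Algebra.Properties.Ring ring using (-‿distribˡ-*)

  minus-plus : ∀ x y → (x - y) + y ≈ x
  minus-plus x y = trans (+-assoc x (- y) y) (trans (+-congˡ (-‿inverseˡ y)) (+-identityʳ x))

  plus-minus : ∀ x y → (x + y) - y ≈ x
  plus-minus x y = trans (+-assoc x y (- y)) (trans (+-congˡ (-‿inverseʳ y)) (+-identityʳ x))

  cancel-left : ∀ u a w → (u + a) - (u + w) ≈ a - w
  cancel-left u a w = begin
      (u + a) + - (u + w)      ≈⟨ +-congˡ (sym (⁻¹-∙-comm u w)) ⟩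
      (u + a) + (- u + - w)    ≈⟨ solve 4 (λ x y z v → (x ⊕ y) ⊕ (z ⊕ v) ⊜ (x ⊕ z) ⊕ (y ⊕ v)) refl u a (- u) (- w) ⟩
      (u + - u) + (a + - w)    ≈⟨ +-congʳ (-‿inverseʳ u) ⟩
      0# + (a - w)             ≈⟨ +-identityˡ _ ⟩
      a - w                    ∎
    where
    open import Algebra.Properties.AbelianGroup +-abelianGroup using (⁻¹-∙-comm)
    open import Algebra.Solver.CommutativeMonoid +-commutativeMonoid using (solve; _⊕_; _⊜_)

module VectorSums {q : ℕ} (F : FiniteField q) where

  open FiniteField F using (Carrier; setoid; sym; trans)
  open Theory F using (Vec; _≈?_)
  open import Data.Nat as ℕ using (zero; suc; _*_)
  import Data.Nat.Properties as ℕP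
  open import Data.Fin using (Fin; zero; suc)
  import Data.Fin.Properties as FinP
  open import Data.Product using (_,_)
  open import Data.Vec.Functional using (_∷_)
  open import Relation.Binary.PropositionalEquality as ≡ using (_≡_)
  open import Function.Base using (_∘_)
  open import Function.Bundles using (Bijection)
  open NatSums

  Enum : Set
  Enum = Bijection (≡.setoid (Fin q)) setoid

  Σvec : ∀ {n} → (Fin n → Enum) → (Vec n → ℕ) → ℕ
  Σvec {zero}  E f = f (λ ())
  Σvec {suc n} E f = sum (λ x → Σvec (E ∘ suc) (λ c → f (Bijection.to (E zero) x ∷ c)))

  Σvec-cong : ∀ {n} (E : Fin n → Enum) {f g : Vec n → ℕ} → (∀ c → f c ≡ g c) → Σvec E f ≡ Σvec E g
  Σvec-cong {zero}  E eq = eq _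
  Σvec-cong {suc n} E eq = sum-cong-≗ {q} (λ x → Σvec-cong (E ∘ suc) (λ c → eq _))

  Σvec-sum : ∀ {n k} (E : Fin n → Enum) (g : Fin k → Vec n → ℕ) →
             Σvec E (λ c → sum (λ x → g x c)) ≡ sum (λ x → Σvec E (g x))
  Σvec-sum {zero}  E g = ≡.refl
  Σvec-sum {suc n} {k} E g = ≡.trans (sum-cong-≗ {q} (λ y → Σvec-sum (E ∘ suc) (λ x c → g x _)))
    (∑-comm {q} {k} (λ y x → Σvec (E ∘ suc) (λ c → g x (Bijection.to (E zero) y ∷ c))))

  enumerated-once : (e : Enum) (y : Carrier) → sum (λ x → ind (Bijection.to e x ≈? y)) ≡ 1
  enumerated-once e y with Bijection.surjective e y
  ... | x₀ , ex₀≈y = ≡.trans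
    (sum-cong-≗ (λ x → ind-iff (Bijection.to e x ≈? y) (x FinP.≟ x₀)
      (λ ex≈y → Bijection.injective e (trans ex≈y (sym (ex₀≈y ≡.refl))))
      (λ { ≡.refl → ex₀≈y ≡.refl })))
    (sum-single x₀)

  Σvec-free : ∀ {n} (E : Fin (suc n) → Enum) (f : Vec (suc n) → ℕ) (f' : Vec n → ℕ) →
              (∀ x c → f (x ∷ c) ≡ f' c) → Σvec E f ≡ q * Σvec (E ∘ suc) f'
  Σvec-free E f f' eq = ≡.trans (sum-cong-≗ {q} (λ x → Σvec-cong (E ∘ suc) (eq _))) (sum-const q _)

  Σvec-determined : ∀ {n} (E : Fin (suc n) → Enum) (f : Vec (suc n) → ℕ) (f' : Vec n → ℕ) (g : Vec n → Carrier) →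
                    (∀ x c → f (x ∷ c) ≡ f' c * ind (x ≈? g c)) → Σvec E f ≡ Σvec (E ∘ suc) f'
  Σvec-determined E f f' g eq = begin
      sum (λ x → Σvec E′ (λ c → f (e₀ x ∷ c)))
        ≡⟨ sum-cong-≗ {q} (λ x → Σvec-cong E′ (eq (e₀ x))) ⟩
      sum (λ x → Σvec E′ (λ c → f' c * ind (e₀ x ≈? g c)))
        ≡⟨ Σvec-sum E′ (λ x c → f' c * ind (e₀ x ≈? g c)) ⟨
      Σvec E′ (λ c → sum (λ x → f' c * ind (e₀ x ≈? g c)))
        ≡⟨ Σvec-cong E′ (λ c → ≡.sym (*-distribˡ-sum (f' c) (λ x → ind (e₀ x ≈? g c)))) ⟩
      Σvec E′ (λ c → f' c * sum (λ x → ind (e₀ x ≈? g c)))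
        ≡⟨ Σvec-cong E′ (λ c → ≡.trans (≡.cong (f' c *_) (enumerated-once (E zero) (g c))) (ℕP.*-identityʳ _)) ⟩
      Σvec E′ f' ∎
    where
    open ≡.≡-Reasoning
    E′ = E ∘ suc
    e₀ = Bijection.to (E zero)

-- Counting solutions of independent linear systems (Gaussian elimination)

-- Equations are indexed by pairs (i, j) ∈ Fin s × Fin m; a mask selects the
-- equations that are imposed.  Coefficient families indexed like the
-- equations are elements of Space s m.
module LinearSystems {q : ℕ} (F : FiniteField q) (s m : ℕ) where

  open FiniteField F hiding (zero)
  open Theory F using (Vec; Space; _≈?_)
  open FieldSums F
  open VectorSums F using (Enum; Σvec; Σvec-free; Σvec-determined)
  open NatSums using (ind; ind-iff; ind-yes; ind-×; sum-bump; sum-const) renaming (sum to sumℕ)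
  open import Data.Nat as ℕ using (zero; suc; _^_)
  import Data.Nat.Properties as ℕP
  open import Data.Bool using (Bool; true; false; T; if_then_else_)
  open import Data.Fin using (Fin; zero; suc)
  import Data.Fin.Properties as FinP
  open import Data.Product using (_×_; _,_; proj₁; proj₂)
  open import Data.Empty using (⊥-elim)
  open import Data.Unit using (tt)
  open import Data.Vec.Functional using (_∷_)
  open import Relation.Nullary using (¬_; Dec; yes; no; ¬?)
  open import Relation.Nullary.Decidable using (_×-dec_; _→-dec_; T?)
  open import Relation.Binary.PropositionalEquality as ≡ using (_≡_)
  import Relation.Binary.Reasoning.Setoid
  open import Function.Base using (_∘_)
  open import Algebra.Properties.CommutativeSemigroup ℕP.*-commutativeSemigroup using (x∙yz≈y∙xz)
  module ≈-Reasoning = Relation.Binary.Reasoning.Setoid setoid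

  Mask : Set
  Mask = Fin s → Fin m → Bool

  Rows : ℕ → Set
  Rows n = Fin s → Fin m → Vec n

  active : Mask → ℕ
  active M = sumℕ (λ i → sumℕ (λ j → if M i j then 1 else 0))

  Solves : ∀ {n} → Mask → Rows n → Space s m → Vec n → Set
  Solves M R t c = ∀ i j → T (M i j) → dotv (R i j) c ≈ t i j

  solves? : ∀ {n} (M : Mask) (R : Rows n) (t : Space s m) (c : Vec n) → Dec (Solves M R t c)
  solves? M R t c = FinP.all? (λ i → FinP.all? (λ j → T? (M i j) →-dec (dotv (R i j) c ≈? t i j)))

  Σ2 : Space s m → Carrier
  Σ2 f = sum (λ i → sum (λ j → f i j))

  Σ2-cong : ∀ {f g : Space s m} → (∀ i j → f i j ≈ g i j) → Σ2 f ≈ Σ2 g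
  Σ2-cong eq = sum-cong-≋ {s} (λ i → sum-cong-≋ {m} (eq i))

  Σ2-zero : ∀ {f : Space s m} → (∀ i j → f i j ≈ 0#) → Σ2 f ≈ 0#
  Σ2-zero eq = sum-zero {s} (λ i → sum-zero {m} (eq i))

  Σ2-+ : ∀ (f g : Space s m) → Σ2 (λ i j → f i j + g i j) ≈ Σ2 f + Σ2 g
  Σ2-+ f g = trans (sum-cong-≋ {s} (λ i → ∑-distrib-+ {m} (f i) (g i))) (∑-distrib-+ {s} _ _)

  Σ2-*ʳ : ∀ c (f : Space s m) → Σ2 f * c ≈ Σ2 (λ i j → f i j * c)
  Σ2-*ʳ c f = trans (*-distribʳ-sum {s} c _) (sum-cong-≋ {s} (λ i → *-distribʳ-sum {m} c (f i)))

  Independent : ∀ {n} → Mask → Rows n → Set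
  Independent {n} M R = ∀ (l : Space s m) → (∀ i j → ¬ T (M i j) → l i j ≈ 0#) →
                        (∀ k → Σ2 (λ i j → l i j * R i j k) ≈ 0#) → ∀ i j → l i j ≈ 0#

  at? : (p₁ : Fin s) (p₂ : Fin m) (i : Fin s) (j : Fin m) → Dec (i ≡ p₁ × j ≡ p₂)
  at? p₁ p₂ i j = (i FinP.≟ p₁) ×-dec (j FinP.≟ p₂)

  single : Fin s → Fin m → Space s m
  single p₁ p₂ i j with at? p₁ p₂ i j
  ... | yes _ = 1#
  ... | no  _ = 0#

  single-at : ∀ p₁ p₂ → single p₁ p₂ p₁ p₂ ≈ 1#
  single-at p₁ p₂ with at? p₁ p₂ p₁ p₂
  ... | yes _ = refl
  ... | no ¬p = ⊥-elim (¬p (≡.refl , ≡.refl))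

  single-elsewhere : ∀ p₁ p₂ i j → ¬ (i ≡ p₁ × j ≡ p₂) → single p₁ p₂ i j ≈ 0#
  single-elsewhere p₁ p₂ i j ¬p with at? p₁ p₂ i j
  ... | yes p = ⊥-elim (¬p p)
  ... | no  _ = refl

  Σ2-single : ∀ p₁ p₂ (f : Space s m) → Σ2 (λ i j → single p₁ p₂ i j * f i j) ≈ f p₁ p₂
  Σ2-single p₁ p₂ f = begin
      Σ2 (λ i j → single p₁ p₂ i j * f i j)
        ≈⟨ sum-at {s} _ p₁ (λ i i≢p₁ → sum-zero {m} (λ j → vanish i j (i≢p₁ ∘ proj₁))) ⟩
      sum (λ j → single p₁ p₂ p₁ j * f p₁ j)
        ≈⟨ sum-at {m} _ p₂ (λ j j≢p₂ → vanish p₁ j (j≢p₂ ∘ proj₂)) ⟩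
      single p₁ p₂ p₁ p₂ * f p₁ p₂
        ≈⟨ trans (*-congʳ (single-at p₁ p₂)) (*-identityˡ _) ⟩
      f p₁ p₂ ∎
    where
    open ≈-Reasoning
    vanish : ∀ i j → ¬ (i ≡ p₁ × j ≡ p₂) → single p₁ p₂ i j * f i j ≈ 0#
    vanish i j ¬p = trans (*-congʳ (single-elsewhere p₁ p₂ i j ¬p)) (zeroˡ _)

  -- An independent system in no unknowns imposes no equation: otherwise
  -- 'single i j' would be a nontrivial vanishing combination.
  none-imposed : (M : Mask) (R : Rows 0) → Independent M R → ∀ i j → ¬ T (M i j)
  none-imposed M R indep i j imposed =
    0≉1 (sym (trans (sym (single-at i j)) (indep (single i j) support (λ ()) i j)))
    where
    support : ∀ i' j' → ¬ T (M i' j') → single i j i' j' ≈ 0#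
    support i' j' ¬imposed = single-elsewhere i j i' j'
      (λ { (≡.refl , ≡.refl) → ¬imposed imposed })

  active-none : (M : Mask) → (∀ i j → ¬ T (M i j)) → active M ≡ 0
  active-none M off = ≡.trans (NatSums.sum-cong-≗ {s} (λ i →
      ≡.trans (NatSums.sum-cong-≗ {m} (λ j → off-count (M i j) (off i j))) (≡.trans (sum-const m 0) (ℕP.*-zeroʳ m))))
    (≡.trans (sum-const s 0) (ℕP.*-zeroʳ s))
    where
    off-count : ∀ b → ¬ T b → (if b then 1 else 0) ≡ 0
    off-count true  ¬t = ⊥-elim (¬t tt)
    off-count false _  = ≡.refl

  remove : Fin s → Fin m → Mask → Mask
  remove p₁ p₂ M i j with at? p₁ p₂ i j
  ... | yes _ = false
  ... | no  _ = M i j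

  remove-elsewhere : ∀ p₁ p₂ M i j → ¬ (i ≡ p₁ × j ≡ p₂) → remove p₁ p₂ M i j ≡ M i j
  remove-elsewhere p₁ p₂ M i j ¬p with at? p₁ p₂ i j
  ... | yes p = ⊥-elim (¬p p)
  ... | no  _ = ≡.refl

  remove-at : ∀ p₁ p₂ M → remove p₁ p₂ M p₁ p₂ ≡ false
  remove-at p₁ p₂ M with at? p₁ p₂ p₁ p₂
  ... | yes _ = ≡.refl
  ... | no ¬p = ⊥-elim (¬p (≡.refl , ≡.refl))

  imposed-after-remove : ∀ p₁ p₂ M i j → T (remove p₁ p₂ M i j) → T (M i j) × ¬ (i ≡ p₁ × j ≡ p₂)
  imposed-after-remove p₁ p₂ M i j t with at? p₁ p₂ i j
  ... | yes _ = ⊥-elim t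
  ... | no ¬p = t , ¬p

  active-remove : ∀ p₁ p₂ M → T (M p₁ p₂) → active M ≡ suc (active (remove p₁ p₂ M))
  active-remove p₁ p₂ M imposed =
    sum-bump p₁ _ _ (λ i i≢p₁ → NatSums.sum-cong-≗ (λ j → ≡.cong count (≡.sym (remove-elsewhere p₁ p₂ M i j (i≢p₁ ∘ proj₁)))))
      (sum-bump p₂ _ _ (λ j j≢p₂ → ≡.cong count (≡.sym (remove-elsewhere p₁ p₂ M p₁ j (j≢p₂ ∘ proj₂))))
        (≡.trans (≡.cong count (T⇒true imposed)) (≡.cong (λ b → suc (count b)) (≡.sym (remove-at p₁ p₂ M)))))
    where
    count : Bool → ℕ
    count b = if b then 1 else 0
    T⇒true : ∀ {b} → T b → b ≡ true
    T⇒true {true} _ = ≡.refl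

  -- If every imposed row starts with 0, the first unknown is free.
  module FreeUnknown {n} (M : Mask) (R : Rows (suc n))
                     (leading-zero : ∀ i j → T (M i j) → R i j zero ≈ 0#) where

    R₀ : Rows n
    R₀ i j = R i j ∘ suc

    dotv-R₀ : ∀ i j → T (M i j) → ∀ x c → dotv (R i j) (x ∷ c) ≈ dotv (R₀ i j) c
    dotv-R₀ i j imposed x c =
      trans (+-congʳ (trans (*-congʳ (leading-zero i j imposed)) (zeroˡ x))) (+-identityˡ _)

    solves-R₀ : ∀ t x c → ind (solves? M R t (x ∷ c)) ≡ ind (solves? M R₀ t c)
    solves-R₀ t x c = ind-iff (solves? M R t (x ∷ c)) (solves? M R₀ t c)
      (λ h i j imposed → trans (sym (dotv-R₀ i j imposed x c)) (h i j imposed))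
      (λ h i j imposed → trans (dotv-R₀ i j imposed x c) (h i j imposed))

    independent-R₀ : Independent M R → Independent M R₀
    independent-R₀ indep l support combination = indep l support λ
      { zero    → Σ2-zero (λ i j → leading-term i j)
      ; (suc k) → combination k }
      where
      leading-term : ∀ i j → l i j * R i j zero ≈ 0#
      leading-term i j with T? (M i j)
      ... | yes imposed = trans (*-congˡ (leading-zero i j imposed)) (zeroʳ _)
      ... | no ¬imposed = trans (*-congʳ (support i j ¬imposed)) (zeroˡ _)

  -- Elimination with the pivot α = R p₁ p₂ 0 ≠ 0 of an imposed equation:
  -- subtracting multiples of the pivot row clears the first column, the
  -- pivot equation then determines the first unknown, and the remaining
  -- equations form a system in n unknowns.
  module Elimination {n} (M : Mask) (R : Rows (suc n)) (t : Space s m)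
                     (p₁ : Fin s) (p₂ : Fin m) (imposed : T (M p₁ p₂)) (α≉0 : ¬ (R p₁ p₂ zero ≈ 0#)) where

    open ≈-Reasoning

    Rp : Vec (suc n)
    Rp = R p₁ p₂

    α α⁻¹ : Carrier
    α   = Rp zero
    α⁻¹ = proj₁ (inverse α α≉0)

    α⁻¹α : α⁻¹ * α ≈ 1#
    α⁻¹α = trans (*-comm α⁻¹ α) (proj₂ (inverse α α≉0))

    β : Space s m
    β i j = R i j zero * α⁻¹

    βα : ∀ i j → β i j * α ≈ R i j zero
    βα i j = trans (*-assoc _ α⁻¹ α) (trans (*-congˡ α⁻¹α) (*-identityʳ _))

    M' : Mask
    M' = remove p₁ p₂ M

    R' : Rows n
    R' i j k = R i j (suc k) - β i j * Rp (suc k)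

    t' : Space s m
    t' i j = t i j - β i j * t p₁ p₂

    pivot-value : Vec n → Carrier
    pivot-value c = α⁻¹ * (t p₁ p₂ - dotv (Rp ∘ suc) c)

    row-operation : ∀ i j x c → dotv (R i j) (x ∷ c) - β i j * dotv Rp (x ∷ c) ≈ dotv (R' i j) c
    row-operation i j x c = begin
        (R i j zero * x + A) - β i j * (α * x + B)
          ≈⟨ -‿cong-right (trans (distribˡ (β i j) (α * x) B) (+-congʳ (trans (sym (*-assoc _ α x)) (*-congʳ (βα i j))))) ⟩
        (R i j zero * x + A) - (R i j zero * x + β i j * B)
          ≈⟨ cancel-left (R i j zero * x) A (β i j * B) ⟩
        A - β i j * B
          ≈⟨ dotv-linear (R i j ∘ suc) (Rp ∘ suc) c (β i j) ⟨
        dotv (R' i j) c ∎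
      where
      A = dotv (R i j ∘ suc) c
      B = dotv (Rp ∘ suc) c
      -‿cong-right : ∀ {u v w} → v ≈ w → u - v ≈ u - w
      -‿cong-right v≈w = +-congˡ (-‿cong v≈w)

    pivot-equation⇒ : ∀ x c → dotv Rp (x ∷ c) ≈ t p₁ p₂ → x ≈ pivot-value c
    pivot-equation⇒ x c h = begin
        x                                ≈⟨ sym (*-identityˡ x) ⟩
        1# * x                           ≈⟨ *-congʳ (sym α⁻¹α) ⟩
        (α⁻¹ * α) * x                    ≈⟨ *-assoc α⁻¹ α x ⟩
        α⁻¹ * (α * x)                    ≈⟨ *-congˡ (sym (plus-minus (α * x) B)) ⟩
        α⁻¹ * ((α * x + B) - B)          ≈⟨ *-congˡ (+-congʳ h) ⟩
        pivot-value c                    ∎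
      where B = dotv (Rp ∘ suc) c

    pivot-equation⇐ : ∀ x c → x ≈ pivot-value c → dotv Rp (x ∷ c) ≈ t p₁ p₂
    pivot-equation⇐ x c h = begin
        α * x + B                        ≈⟨ +-congʳ (*-congˡ h) ⟩
        α * (α⁻¹ * (t p₁ p₂ - B)) + B    ≈⟨ +-congʳ (sym (*-assoc α α⁻¹ _)) ⟩
        (α * α⁻¹) * (t p₁ p₂ - B) + B    ≈⟨ +-congʳ (trans (*-congʳ (proj₂ (inverse α α≉0))) (*-identityˡ _)) ⟩
        (t p₁ p₂ - B) + B                ≈⟨ minus-plus (t p₁ p₂) B ⟩
        t p₁ p₂                          ∎
      where B = dotv (Rp ∘ suc) c

    solves⇒ : ∀ x c → Solves M R t (x ∷ c) → Solves M' R' t' c × x ≈ pivot-value c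
    solves⇒ x c h = reduced , pivot-equation⇒ x c (h p₁ p₂ imposed)
      where
      reduced : Solves M' R' t' c
      reduced i j imposed' = begin
          dotv (R' i j) c                                  ≈⟨ sym (row-operation i j x c) ⟩
          dotv (R i j) (x ∷ c) - β i j * dotv Rp (x ∷ c)   ≈⟨ +-cong (h i j (proj₁ (imposed-after-remove p₁ p₂ M i j imposed')))
                                                                       (-‿cong (*-congˡ (h p₁ p₂ imposed))) ⟩
          t' i j                                           ∎

    solves⇐ : ∀ x c → Solves M' R' t' c → x ≈ pivot-value c → Solves M R t (x ∷ c)
    solves⇐ x c h' x≈ i j imposedᵢⱼ with at? p₁ p₂ i j
    ... | yes (≡.refl , ≡.refl) = pivot-equation⇐ x c x≈
    ... | no ¬p = begin
        dotv (R i j) (x ∷ c)                                        ≈⟨ sym (minus-plus _ _) ⟩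
        (dotv (R i j) (x ∷ c) - β i j * dotv Rp (x ∷ c)) + β i j * dotv Rp (x ∷ c)
          ≈⟨ +-cong (trans (row-operation i j x c) (h' i j imposed')) (*-congˡ (pivot-equation⇐ x c x≈)) ⟩
        (t i j - β i j * t p₁ p₂) + β i j * t p₁ p₂                 ≈⟨ minus-plus _ _ ⟩
        t i j                                                        ∎
      where
      imposed' : T (M' i j)
      imposed' = ≡.subst T (≡.sym (remove-elsewhere p₁ p₂ M i j ¬p)) imposedᵢⱼ

    row-decomposition : ∀ i j k → R i j k ≈ (0# ∷ R' i j) k + β i j * Rp k
    row-decomposition i j zero    = sym (trans (+-identityˡ _) (βα i j))
    row-decomposition i j (suc k) = sym (minus-plus _ _)

    -- Elimination preserves independence: a vanishing combination μ of the
    -- reduced rows lifts to the vanishing combination μ + γ·single p of the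
    -- original rows, with γ = - Σ μ β.
    independent-reduced : Independent M R → Independent M' R'
    independent-reduced indep μ support combination i j with at? p₁ p₂ i j
    ... | yes (≡.refl , ≡.refl) = support p₁ p₂ (λ t → ≡.subst T (remove-at p₁ p₂ M) t)
    ... | no ¬p = trans (sym (l≈μ i j ¬p)) (indep l l-support l-combination i j)
      where
      γ : Carrier
      γ = - Σ2 (λ i j → μ i j * β i j)

      l : Space s m
      l i j = μ i j + single p₁ p₂ i j * γ

      l≈μ : ∀ i j → ¬ (i ≡ p₁ × j ≡ p₂) → l i j ≈ μ i j
      l≈μ i j ¬p = trans (+-congˡ (trans (*-congʳ (single-elsewhere p₁ p₂ i j ¬p)) (zeroˡ γ))) (+-identityʳ _)

      l-support : ∀ i j → ¬ T (M i j) → l i j ≈ 0#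
      l-support i j ¬imposed = trans (l≈μ i j not-pivot) (support i j (¬imposed ∘ proj₁ ∘ imposed-after-remove p₁ p₂ M i j))
        where
        not-pivot : ¬ (i ≡ p₁ × j ≡ p₂)
        not-pivot (≡.refl , ≡.refl) = ¬imposed imposed

      reduced-combination : ∀ k → Σ2 (λ i j → μ i j * (0# ∷ R' i j) k) ≈ 0#
      reduced-combination zero    = Σ2-zero (λ i j → zeroʳ _)
      reduced-combination (suc k) = combination k

      l-combination : ∀ k → Σ2 (λ i j → l i j * R i j k) ≈ 0#
      l-combination k = begin
          Σ2 (λ i j → l i j * R i j k)
            ≈⟨ Σ2-cong (λ i j → trans (distribʳ (R i j k) (μ i j) _) (+-congˡ (*-assoc _ γ _))) ⟩
          Σ2 (λ i j → μ i j * R i j k + single p₁ p₂ i j * (γ * R i j k))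
            ≈⟨ trans (Σ2-+ _ _) (+-congˡ (Σ2-single p₁ p₂ (λ i j → γ * R i j k))) ⟩
          Σ2 (λ i j → μ i j * R i j k) + γ * Rp k
            ≈⟨ +-congʳ (Σ2-cong (λ i j → trans (*-congˡ (row-decomposition i j k)) (distribˡ (μ i j) _ _))) ⟩
          Σ2 (λ i j → μ i j * (0# ∷ R' i j) k + μ i j * (β i j * Rp k)) + γ * Rp k
            ≈⟨ +-congʳ (trans (Σ2-+ _ _) (+-cong (reduced-combination k) (Σ2-cong (λ i j → sym (*-assoc _ _ _))))) ⟩
          (0# + Σ2 (λ i j → (μ i j * β i j) * Rp k)) + γ * Rp k
            ≈⟨ +-congʳ (trans (+-identityˡ _) (sym (Σ2-*ʳ (Rp k) _))) ⟩
          Σ2 (λ i j → μ i j * β i j) * Rp k + γ * Rp k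
            ≈⟨ sym (distribʳ (Rp k) _ γ) ⟩
          (Σ2 (λ i j → μ i j * β i j) + γ) * Rp k
            ≈⟨ trans (*-congʳ (-‿inverseʳ _)) (zeroˡ _) ⟩
          0# ∎

  solution-count : ∀ n (E : Fin n → Enum) (M : Mask) (R : Rows n) → Independent M R → ∀ t →
                   Σvec E (λ c → ind (solves? M R t c)) ℕ.* q ^ active M ≡ q ^ n
  solution-count zero E M R indep t = ≡.cong₂ ℕ._*_
    (ind-yes (solves? M R t (λ ())) (λ i j imposed → ⊥-elim (none-imposed M R indep i j imposed)))
    (≡.cong (q ^_) (active-none M (none-imposed M R indep)))
  solution-count (suc n) E M R indep t
    with FinP.any? (λ i → FinP.any? (λ j → T? (M i j) ×-dec ¬? (R i j zero ≈? 0#)))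
  ... | no no-pivot = begin
      Σvec E (λ c → ind (solves? M R t c)) ℕ.* q ^ active M
        ≡⟨ ≡.cong (ℕ._* q ^ active M) (Σvec-free E (λ c → ind (solves? M R t c)) (λ c → ind (solves? M R₀ t c)) (solves-R₀ t)) ⟩
      q ℕ.* Σvec (E ∘ suc) (λ c → ind (solves? M R₀ t c)) ℕ.* q ^ active M
        ≡⟨ ℕP.*-assoc q _ _ ⟩
      q ℕ.* (Σvec (E ∘ suc) (λ c → ind (solves? M R₀ t c)) ℕ.* q ^ active M)
        ≡⟨ ≡.cong (q ℕ.*_) (solution-count n (E ∘ suc) M R₀ (independent-R₀ indep) t) ⟩
      q ^ suc n ∎
    where
    open ≡.≡-Reasoning
    leading-zero : ∀ i j → T (M i j) → R i j zero ≈ 0#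
    leading-zero i j imposed with R i j zero ≈? 0#
    ... | yes z = z
    ... | no nz = ⊥-elim (no-pivot (i , j , imposed , nz))
    open FreeUnknown M R leading-zero
  ... | yes (p₁ , p₂ , imposed , α≉0) = begin
      Σvec E (λ c → ind (solves? M R t c)) ℕ.* q ^ active M
        ≡⟨ ≡.cong₂ ℕ._*_ (Σvec-determined E (λ c → ind (solves? M R t c)) (λ c → ind (solves? M' R' t' c)) pivot-value split) (≡.cong (q ^_) (active-remove p₁ p₂ M imposed)) ⟩
      Σvec (E ∘ suc) (λ c → ind (solves? M' R' t' c)) ℕ.* (q ℕ.* q ^ active M')
        ≡⟨ x∙yz≈y∙xz (Σvec (E ∘ suc) (λ c → ind (solves? M' R' t' c))) q (q ^ active M') ⟩
      q ℕ.* (Σvec (E ∘ suc) (λ c → ind (solves? M' R' t' c)) ℕ.* q ^ active M')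
        ≡⟨ ≡.cong (q ℕ.*_) (solution-count n (E ∘ suc) M' R' (independent-reduced indep) t') ⟩
      q ^ suc n ∎
    where
    open ≡.≡-Reasoning
    open Elimination M R t p₁ p₂ imposed α≉0
    split : ∀ x c → ind (solves? M R t (x ∷ c)) ≡ ind (solves? M' R' t' c) ℕ.* ind (x ≈? pivot-value c)
    split x c = ≡.trans
      (ind-iff (solves? M R t (x ∷ c)) (solves? M' R' t' c ×-dec (x ≈? pivot-value c))
               (solves⇒ x c) (λ (h , x≈) → solves⇐ x c h x≈))
      (ind-× (solves? M' R' t' c) (x ≈? pivot-value c))

module DigitEnumeration {q : ℕ} (F : FiniteField q) where

  open Theory F using (digit; Vec; q-nonZero)
  open VectorSums F using (Enum; Σvec)
  open NatSums using (sum; sum-cong-≗; Σ<; Σ<-cong; Σ<-blocks; Σ<-as-sum; Σ<-sum-comm)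
  open Radix q using (quotient; remainder)
  open import Data.Nat as ℕ using (zero; suc; _+_; _*_; _^_; _/_; _%_)
  import Data.Nat.Properties as ℕP
  open import Data.Nat.DivMod using (n/1≡n; m/n/o≡m/[n*o])
  open import Data.Fin using (Fin; zero; suc; toℕ)
  import Data.Fin.Properties as FinP
  open import Data.Vec.Functional using (_∷_)
  open import Relation.Binary.PropositionalEquality
  open import Function.Base using (_∘_)
  open import Function.Bundles using (Bijection)

  toℕ-digit : ∀ n k → toℕ (digit n k) ≡ _/_ n (q ^ k) {{ℕP.m^n≢0 q k}} % q
  toℕ-digit n k = FinP.toℕ-fromℕ< _

  digit-zero : ∀ n' (x : Fin q) → digit (n' * q + toℕ x) 0 ≡ x
  digit-zero n' x = FinP.toℕ-injective (begin
      toℕ (digit (n' * q + toℕ x) 0)  ≡⟨ toℕ-digit (n' * q + toℕ x) 0 ⟩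
      (n' * q + toℕ x) / 1 % q        ≡⟨ cong (_% q) (n/1≡n (n' * q + toℕ x)) ⟩
      (n' * q + toℕ x) % q            ≡⟨ remainder n' (FinP.toℕ<n x) ⟩
      toℕ x                           ∎)
    where open ≡-Reasoning

  digit-suc : ∀ n' (x : Fin q) k → digit (n' * q + toℕ x) (suc k) ≡ digit n' k
  digit-suc n' x k = FinP.toℕ-injective (begin
      toℕ (digit N (suc k))                          ≡⟨ toℕ-digit N (suc k) ⟩
      _/_ N (q * q ^ k) {{ℕP.m^n≢0 q (suc k)}} % q   ≡⟨ cong (_% q) (m/n/o≡m/[n*o] N q (q ^ k) {{_}} {{ℕP.m^n≢0 q k}} {{ℕP.m^n≢0 q (suc k)}}) ⟨
      _/_ (N / q) (q ^ k) {{ℕP.m^n≢0 q k}} % q        ≡⟨ cong (λ w → _/_ w (q ^ k) {{ℕP.m^n≢0 q k}} % q) (quotient n' (FinP.toℕ<n x)) ⟩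
      _/_ n' (q ^ k) {{ℕP.m^n≢0 q k}} % q             ≡⟨ toℕ-digit n' k ⟨
      toℕ (digit n' k)                               ∎)
    where
    open ≡-Reasoning
    N = n' * q + toℕ x

  digitVector : ∀ {m} → (Fin m → Enum) → ℕ → Vec m
  digitVector E n r = Bijection.to (E r) (digit n (toℕ r))

  Extensional : ∀ {m} → (Vec m → ℕ) → Set
  Extensional {m} h = ∀ c c' → (∀ r → c r ≡ c' r) → h c ≡ h c'

  Σ<-digitVector : ∀ m (E : Fin m → Enum) (h : Vec m → ℕ) → Extensional h →
                   Σ< (q ^ m) (λ n → h (digitVector E n)) ≡ Σvec E h
  Σ<-digitVector zero    E h ext = trans (ℕP.+-identityʳ _) (ext _ _ (λ ()))
  Σ<-digitVector (suc m) E h ext = begin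
      Σ< (q * q ^ m) G
        ≡⟨ cong (λ w → Σ< w G) (ℕP.*-comm q (q ^ m)) ⟩
      Σ< (q ^ m * q) G
        ≡⟨ Σ<-blocks (q ^ m) q G ⟩
      Σ< (q ^ m) (λ n' → Σ< q (λ x → G (n' * q + x)))
        ≡⟨ Σ<-cong (q ^ m) (λ n' _ → Σ<-as-sum q (λ x → G (n' * q + x))) ⟩
      Σ< (q ^ m) (λ n' → sum (λ (x : Fin q) → G (n' * q + toℕ x)))
        ≡⟨ Σ<-sum-comm (q ^ m) {q} (λ n' x → G (n' * q + toℕ x)) ⟩
      sum (λ (x : Fin q) → Σ< (q ^ m) (λ n' → G (n' * q + toℕ x)))
        ≡⟨ sum-cong-≗ {q} (λ x → trans (Σ<-cong (q ^ m) (λ n' _ → ext _ _ (split n' x)))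
                                       (Σ<-digitVector m (E ∘ suc) (λ c → h (e₀ x ∷ c)) (λ c c' eq → ext _ _ (tail-eq eq)))) ⟩
      Σvec E h ∎
    where
    open ≡-Reasoning
    G : ℕ → ℕ
    G n = h (digitVector E n)
    e₀ = Bijection.to (E zero)
    split : ∀ n' x r → digitVector E (n' * q + toℕ x) r ≡ (e₀ x ∷ digitVector (E ∘ suc) n') r
    split n' x zero    = cong e₀ (digit-zero n' x)
    split n' x (suc r) = cong (Bijection.to (E (suc r))) (digit-suc n' x (toℕ r))
    tail-eq : ∀ {x c c'} → (∀ r → c r ≡ c' r) → ∀ r → (x ∷ c) r ≡ (x ∷ c') r
    tail-eq eq zero    = refl
    tail-eq eq (suc r) = eq r

module Support {q : ℕ} (F : FiniteField q) where

  open FiniteField F hiding (zero)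
  open Theory F
  open Weight using (weight)
  open import Data.Nat as ℕ using (zero; suc; _≤_; z≤n; s≤s)
  import Data.Nat.Properties as ℕP
  open import Data.Fin using (Fin; zero; suc; toℕ)
  import Data.Fin.Properties as FinP
  open import Data.Empty using (⊥-elim)
  open import Relation.Nullary using (Dec; yes; no)
  open import Relation.Binary.PropositionalEquality as ≡ using (_≡_)
  open import Function.Base using (_∘_)

  vanish-beyond-lastNZ : ∀ {m} (a : Vec m) j → lastNZ a ≤ toℕ j → a j ≈ 0#
  vanish-beyond-lastNZ {suc m} a j le with lastNZ (a ∘ suc) in eq
  vanish-beyond-lastNZ {suc m} a zero () | suc k
  vanish-beyond-lastNZ {suc m} a (suc j) (s≤s le) | suc k =
    vanish-beyond-lastNZ (a ∘ suc) j (≡.subst (_≤ toℕ j) (≡.sym eq) le)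
  ... | zero with a zero ≈? 0#
  vanish-beyond-lastNZ {suc m} a zero    le | zero | yes a₀≈0 = a₀≈0
  vanish-beyond-lastNZ {suc m} a zero    () | zero | no _
  vanish-beyond-lastNZ {suc m} a (suc j) _  | zero | _ =
    vanish-beyond-lastNZ (a ∘ suc) j (≡.subst (_≤ toℕ j) (≡.sym eq) z≤n)

  lastNZ-least : ∀ {m} (a : Vec m) d → (∀ j → d ≤ toℕ j → a j ≈ 0#) → lastNZ a ≤ d
  lastNZ-least {zero}  a d h = z≤n
  lastNZ-least {suc m} a d h with lastNZ (a ∘ suc) in eq
  lastNZ-least {suc m} a zero h | suc k with () ← ≡.subst (_≤ 0) eq (lastNZ-least (a ∘ suc) 0 (λ j _ → h (suc j) z≤n))
  lastNZ-least {suc m} a (suc d) h | suc k =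
    s≤s (≡.subst (_≤ d) eq (lastNZ-least (a ∘ suc) d (λ j le → h (suc j) (s≤s le))))
  ... | zero with a zero ≈? 0#
  ...   | yes _ = z≤n
  lastNZ-least {suc m} a zero    h | zero | no a₀≉0 = ⊥-elim (a₀≉0 (h zero z≤n))
  lastNZ-least {suc m} a (suc d) h | zero | no _    = s≤s z≤n

  lastNZ-cong : ∀ {m} (a b : Vec m) → (∀ j → a j ≈ b j) → lastNZ a ≡ lastNZ b
  lastNZ-cong a b eq = ℕP.≤-antisym
    (lastNZ-least a _ (λ j le → trans (eq j) (vanish-beyond-lastNZ b j le)))
    (lastNZ-least b _ (λ j le → trans (sym (eq j)) (vanish-beyond-lastNZ a j le)))

  v≡weight : ∀ e .{{_ : NonZero e}} {m} (a : Vec m) → v e a ≡ weight e m (lastNZ a)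
  v≡weight e a with lastNZ a
  ... | zero  = ≡.refl
  ... | suc k = ≡.refl

  _≈S_ : ∀ {s m} → Space s m → Space s m → Set
  A ≈S B = ∀ i j → A i j ≈ B i j

  V-cong : ∀ {s m} (e : Fin s → ℕ) enz (A B : Space s m) → A ≈S B → V e enz A ≡ V e enz B
  V-cong {zero}      e enz A B eq = ≡.refl
  V-cong {suc s} {m} e enz A B eq = ≡.cong₂ ℕ._+_
    (≡.trans (v≡weight (e zero) {{enz zero}} (A zero))
      (≡.trans (≡.cong (weight (e zero) {{enz zero}} m) (lastNZ-cong (A zero) (B zero) (eq zero)))
               (≡.sym (v≡weight (e zero) {{enz zero}} (B zero)))))
    (V-cong (e ∘ suc) (enz ∘ suc) (A ∘ suc) (B ∘ suc) (eq ∘ suc))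

  IsZero? : ∀ {s m} (A : Space s m) → Dec (IsZero A)
  IsZero? A = FinP.all? (λ i → FinP.all? (λ j → A i j ≈? 0#))

-- Minimum distances exist: exhaustive search over the finite space

module LeastNumber where

  open import Data.Nat
  open import Data.Nat.Properties using (n<1+n; m≤n⇒m<n∨m≡n)
  open import Data.Empty using (⊥-elim)
  open import Data.Product using (Σ; _×_; _,_)
  open import Data.Sum using (_⊎_; inj₁; inj₂; [_,_])
  open import Relation.Nullary using (¬_; Dec; yes; no)
  open import Relation.Binary.PropositionalEquality using (refl)

  Least : (ℕ → Set) → ℕ → Set
  Least R w = R w × (∀ v → v < w → ¬ R v)

  search : ∀ {R : ℕ → Set} → (∀ n → Dec (R n)) → ∀ n → Σ ℕ (Least R) ⊎ (∀ v → v < n → ¬ R v)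
  search R? zero = inj₂ (λ v ())
  search R? (suc n) with search R? n
  ... | inj₁ found = inj₁ found
  ... | inj₂ none with R? n
  ...   | yes r = inj₁ (n , r , none)
  ...   | no ¬r = inj₂ λ v v<1+n → [ none v , (λ { refl → ¬r }) ] (m≤n⇒m<n∨m≡n (s≤s⁻¹ v<1+n))

  least : ∀ {R : ℕ → Set} → (∀ n → Dec (R n)) → ∀ w → R w → Σ ℕ (Least R)
  least R? w r with search R? (suc w)
  ... | inj₁ found = found
  ... | inj₂ none  = ⊥-elim (none w (n<1+n w) r)

module MinimumDistance {q : ℕ} (F : FiniteField q) where

  open FiniteField F hiding (zero)
  open Theory F
  open Support F
  open LeastNumber using (least)
  open import Data.Nat as ℕ using (zero; suc; _≤_)
  import Data.Nat.Properties as ℕP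
  open import Data.Fin using (Fin; zero; suc)
  open import Data.Product using (Σ; _×_; _,_)
  open import Data.Sum using (inj₁; inj₂)
  open import Data.Empty using (⊥-elim)
  open import Data.Vec.Functional using (_∷_)
  open import Relation.Nullary using (¬_; Dec; yes; no; ¬?)
  open import Relation.Nullary.Decidable using (_×-dec_)
  open import Relation.Binary.PropositionalEquality as ≡ using (_≡_)
  import Data.Fin.Properties as FinP
  open import Function.Base using (_∘_)
  open import Function.Bundles using (Bijection)

  Searchable : (X : Set) → (X → X → Set) → Set₁
  Searchable X _~_ = ∀ (P : X → Set) → (∀ x → Dec (P x)) → (∀ {x y} → x ~ y → P x → P y) → Dec (Σ X P)

  searchable-field : Searchable Carrier _≈_
  searchable-field P P? resp with FinP.any? (λ i → P? (Bijection.to enumeration i))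
  ... | yes (i , p) = yes (_ , p)
  ... | no  none    = no λ (x , px) →
    let (i , to-i≈x) = Bijection.surjective enumeration x in none (i , resp (sym (to-i≈x ≡.refl)) px)

  searchable-→ : ∀ n {X : Set} {_~_ : X → X → Set} → (∀ x → x ~ x) → Searchable X _~_ →
                 Searchable (Fin n → X) (λ f g → ∀ i → f i ~ g i)
  searchable-→ zero refl~ search P P? resp with P? (λ ())
  ... | yes p = yes (_ , p)
  ... | no ¬p = no (λ (f , pf) → ¬p (resp (λ ()) pf))
  searchable-→ (suc n) {X} refl~ search P P? resp
    with search (λ x → Σ (Fin n → X) λ g → P (x ∷ g))
           (λ x → searchable-→ n refl~ search (λ g → P (x ∷ g)) (λ g → P? _)
                    (λ g~g' → resp (λ { zero → refl~ x ; (suc i) → g~g' i })))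
           (λ x~y (g , pg) → g , resp (λ { zero → x~y ; (suc i) → refl~ (g i) }) pg)
  ... | yes (x , g , p) = yes (x ∷ g , p)
  ... | no  none        = no (λ (f , pf) → none (f zero , f ∘ suc , resp (λ { zero → refl~ (f zero) ; (suc i) → refl~ (f (suc i)) }) pf))

  searchable-space : ∀ s m → Searchable (Space s m) _≈S_
  searchable-space s m = searchable-→ s (λ A j → refl) (searchable-→ m (λ _ → refl) searchable-field)

  -- δ_{m,e}(N) ≥ k as soon as every nonzero A ∈ N has V(A) ≥ k (k ≤ sm + 1):
  -- either N = {0}, or a nonzero element of least weight realises δ.
  δ≥-intro : ∀ {s m} (e : Fin s → ℕ) enz (N : Space s m → Set) → (∀ A → Dec (N A)) →
             (∀ {A B} → A ≈S B → N A → N B) →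
             ∀ k → k ≤ s ℕ.* m ℕ.+ 1 → (∀ A → N A → ¬ IsZero A → k ≤ V e enz A) → δ≥ e enz N k
  δ≥-intro {s} {m} e enz N N? N-resp k k≤ bound
    with searchable-space s m (λ A → N A × ¬ IsZero A) (λ A → N? A ×-dec ¬? (IsZero? A)) nonzero-resp
    where
    nonzero-resp : ∀ {A B} → A ≈S B → N A × ¬ IsZero A → N B × ¬ IsZero B
    nonzero-resp A≈B (nA , A≉0) = N-resp A≈B nA , λ B≈0 → A≉0 (λ i j → trans (A≈B i j) (B≈0 i j))
  ... | no none = s ℕ.* m ℕ.+ 1 , inj₁ (all-zero , ≡.refl) , k≤
    where
    all-zero : ∀ A → N A → IsZero A
    all-zero A nA with IsZero? A
    ... | yes z = z
    ... | no nz = ⊥-elim (none (A , nA , nz))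
  ... | yes (A₀ , nA₀ , A₀≉0) with least R? (V e enz A₀) (A₀ , nA₀ , A₀≉0 , ≡.refl)
    where
    R : ℕ → Set
    R w = Σ (Space s m) λ A → N A × ¬ IsZero A × V e enz A ≡ w
    R? : ∀ w → Dec (R w)
    R? w = searchable-space s m (λ A → N A × ¬ IsZero A × V e enz A ≡ w)
             (λ A → N? A ×-dec (¬? (IsZero? A) ×-dec (V e enz A ℕP.≟ w)))
             (λ {A} {B} A≈B (nA , A≉0 , VA≡w) → N-resp A≈B nA , (λ B≈0 → A≉0 (λ i j → trans (A≈B i j) (B≈0 i j)))
                                                , ≡.trans (≡.sym (V-cong e enz A B A≈B)) VA≡w)
  ... | w , (A , nA , A≉0 , VA≡w) , minimal =
    w , inj₂ ((A , nA , A≉0 , VA≡w) , (λ B nB B≉0 → ℕP.≮⇒≥ (λ VB<w → minimal (V e enz B) VB<w (B , nB , B≉0 , ≡.refl))))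
      , ≡.subst (k ≤_) VA≡w (bound A nA A≉0)

  δ≥-elim : ∀ {s m} (e : Fin s → ℕ) enz (N : Space s m → Set) k → δ≥ e enz N k →
            ∀ A → N A → ¬ IsZero A → k ≤ V e enz A
  δ≥-elim e enz N k (d , inj₁ (all-zero , _)    , k≤d) A nA A≉0 = ⊥-elim (A≉0 (all-zero A nA))
  δ≥-elim e enz N k (d , inj₂ (_ , d-is-least) , k≤d) A nA A≉0 = ℕP.≤-trans k≤d (d-is-least A nA A≉0)

module DualSpace {q : ℕ} (F : FiniteField q) {s m : ℕ} (Cs : Fin s → Theory.Mat F m) where

  open FiniteField F hiding (zero)
  open Theory F
  open FieldSums F
  open Support F using (_≈S_)
  open LinearSystems F s m using (Σ2; Σ2-cong)
  open import Data.Fin using (Fin)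
  import Data.Fin.Properties as FinP
  open import Data.Product using (_,_)
  open import Relation.Nullary using (Dec; yes; no)
  open import Relation.Binary.PropositionalEquality as ≡ using (_≢_)
  open import Relation.Binary.Reasoning.Setoid setoid

  -- A is orthogonal to every row of C; row r has entry (C_i)_{j,r} at (i, j).
  Orthogonal : Space s m → Set
  Orthogonal A = ∀ r → Σ2 (λ i j → A i j * Cs i j r) ≈ 0#

  dual⇒orthogonal : ∀ A → Dual (RowSpace Cs) A → Orthogonal A
  dual⇒orthogonal A A⊥ r = A⊥ (Cmat Cs r) ((λ r' → I r' r) , λ i j → sym (begin
      sum (λ r' → I r' r * Cs i j r')  ≈⟨ sum-cong-≋ {m} (λ r' → *-comm (I r' r) (Cs i j r')) ⟩
      sum (λ r' → Cs i j r' * I r' r)  ≈⟨ sum-I (Cs i j) r ⟩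
      Cs i j r                         ∎))

  orthogonal⇒dual : ∀ A → Orthogonal A → Dual (RowSpace Cs) A
  orthogonal⇒dual A A⊥ B (c , B≈cC) = begin
      Σ2 (λ i j → A i j * B i j)
        ≈⟨ Σ2-cong (λ i j → trans (*-congˡ (B≈cC i j)) (*-distribˡ-sum {m} (A i j) (λ r → c r * Cs i j r))) ⟩
      sum (λ i → sum (λ j → sum (λ r → A i j * (c r * Cs i j r))))
        ≈⟨ sum-cong-≋ {s} (λ i → ∑-comm {m} {m} (λ j r → A i j * (c r * Cs i j r))) ⟩
      sum (λ i → sum (λ r → sum (λ j → A i j * (c r * Cs i j r))))
        ≈⟨ ∑-comm {s} {m} _ ⟩
      sum (λ r → Σ2 (λ i j → A i j * (c r * Cs i j r)))
        ≈⟨ sum-cong-≋ {m} (λ r → Σ2-cong (λ i j → x∙yz≈y∙xz (A i j) (c r) (Cs i j r))) ⟩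
      sum (λ r → Σ2 (λ i j → c r * (A i j * Cs i j r)))
        ≈⟨ sum-cong-≋ {m} (λ r → trans (sum-cong-≋ {s} (λ i → sym (*-distribˡ-sum {m} (c r) _)))
                                        (sym (*-distribˡ-sum {s} (c r) _))) ⟩
      sum (λ r → c r * Σ2 (λ i j → A i j * Cs i j r))
        ≈⟨ sum-zero {m} (λ r → trans (*-congˡ (A⊥ r)) (zeroʳ _)) ⟩
      0# ∎
    where open import Algebra.Properties.CommutativeSemigroup *-commutativeSemigroup using (x∙yz≈y∙xz)

  dual? : ∀ A → Dec (Dual (RowSpace Cs) A)
  dual? A with FinP.all? (λ r → Σ2 (λ i j → A i j * Cs i j r) ≈? 0#)
  ... | yes A⊥ = yes (orthogonal⇒dual A A⊥)
  ... | no ¬A⊥ = no (λ A⊥ → ¬A⊥ (dual⇒orthogonal A A⊥))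

  dual-resp : ∀ {A B} → A ≈S B → Dual (RowSpace Cs) A → Dual (RowSpace Cs) B
  dual-resp {A} {B} A≈B A⊥ = orthogonal⇒dual B (λ r →
    trans (Σ2-cong (λ i j → *-congʳ (sym (A≈B i j)))) (dual⇒orthogonal A A⊥ r))

  -- If A ⊥ C vanishes outside the block i₀ and C_{i₀} is nonsingular, A = 0:
  -- the block a = A i₀ satisfies a C_{i₀} = 0, hence a = a C_{i₀} N = 0.
  nonsingular-block : ∀ (A : Space s m) i₀ → Nonsingular (Cs i₀) → Orthogonal A →
                      (∀ i → i ≢ i₀ → ∀ j → A i j ≈ 0#) → ∀ j → A i₀ j ≈ 0#
  nonsingular-block A i₀ (N , CN≈I , _) A⊥ others j' = begin
      A i₀ j'
        ≈⟨ sum-I (A i₀) j' ⟨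
      sum (λ j → A i₀ j * I j j')
        ≈⟨ sum-cong-≋ {m} (λ j → *-congˡ (sym (CN≈I j j'))) ⟩
      sum (λ j → A i₀ j * sum (λ k → C j k * N k j'))
        ≈⟨ sum-cong-≋ {m} (λ j → *-distribˡ-sum {m} (A i₀ j) (λ k → C j k * N k j')) ⟩
      sum (λ j → sum (λ k → A i₀ j * (C j k * N k j')))
        ≈⟨ ∑-comm {m} {m} _ ⟩
      sum (λ k → sum (λ j → A i₀ j * (C j k * N k j')))
        ≈⟨ sum-cong-≋ {m} (λ k → trans (sum-cong-≋ {m} (λ j → sym (*-assoc _ _ _)))
                                        (sym (*-distribʳ-sum {m} (N k j') (λ j → A i₀ j * C j k)))) ⟩
      sum (λ k → sum (λ j → A i₀ j * C j k) * N k j')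
        ≈⟨ sum-zero {m} (λ k → trans (*-congʳ (block-orthogonal k)) (zeroˡ _)) ⟩
      0# ∎
    where
    C = Cs i₀
    block-orthogonal : ∀ r → sum (λ j → A i₀ j * C j r) ≈ 0#
    block-orthogonal r = trans
      (sym (sum-at {s} (λ i → sum (λ j → A i j * Cs i j r)) i₀
             (λ i i≢i₀ → sum-zero {m} (λ j → trans (*-congʳ (others i i≢i₀ j)) (zeroˡ _)))))
      (A⊥ r)

module DigitalNets {q : ℕ} (F : FiniteField q) (1<q : 1 < q) {s m : ℕ} (Cs : Fin s → Theory.Mat F m)
                   (η : Fin m → Bijection (PE.setoid (Fin q)) (FiniteField.setoid F))
                   (κ : Fin s → Fin m → Bijection (FiniteField.setoid F) (PE.setoid (Fin q))) where

  open FiniteField F hiding (zero)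
  open Theory F hiding (sumℕ)
  open Net Cs η κ
  open NatSums using (ind; ind-iff; ind-no; Σ<; Σ<-cong; Σ<-zero; length-filter; sum-≥) renaming (sum to sumℕ)
  open Radix q using (Digits; horner; horner-cong; horner-bound; horner-injective; digitOf; digitOf-digits; horner-digitOf)
  open QAdic F using (radix-sum; inBlock⇔prefix; volume; count-equation⇔; volume-bound⇔)
  open VectorSums F using (Σvec)
  open LinearSystems F s m using (Mask; Solves; solves?; active; Independent; single; Σ2; Σ2-cong; Σ2-single; solution-count)
  open DigitEnumeration F using (digitVector; Σ<-digitVector)
  open DualSpace F Cs using (Orthogonal; orthogonal⇒dual)
  open Extend m
  open import Data.Nat as ℕ using (zero; suc; _≤_; _^_; _<?_; _<ᵇ_)
  import Data.Nat.Properties as ℕP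
  open import Data.Nat.Divisibility using (_∣_)
  open import Data.Nat.DivMod using (_%_; m%n<n; m<n⇒m%n≡m)
  open import Data.Fin using (zero; suc; toℕ; fromℕ<)
  import Data.Fin.Properties as FinP
  open import Data.Bool using (T; if_then_else_)
  open import Data.Integer using (+_)
  import Data.Rational as ℚ
  open import Data.Product using (Σ; _×_; _,_; proj₁; proj₂)
  open import Data.Empty using (⊥-elim)
  open import Relation.Nullary using (¬_; yes; no)
  open import Relation.Nullary.Decidable using (decidable-stable)
  open import Relation.Binary.PropositionalEquality as ≡ using (_≡_)
  open import Function.Base using (_∘_)
  open import Function.Bundles using (_⇔_; mk⇔; Equivalence)
  open Equivalence using (to; from)

  κdigits : Fin s → Vec m → ℕ → ℕ
  κdigits i c = extend (λ j → toℕ (Bijection.to (κ i j) (c j)))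

  κdigits-digits : ∀ i c → Digits m (κdigits i c)
  κdigits-digits i c = extend-bound _ q (λ j → FinP.toℕ<n _)

  same-prefix⇔ : ∀ i D → D ≤ m → ∀ c c' →
                 (horner D (κdigits i c) ≡ horner D (κdigits i c')) ⇔ (∀ j → toℕ j < D → c j ≈ c' j)
  same-prefix⇔ i D D≤m c c' = mk⇔
    (λ eq j j<D → Bijection.injective (κ i j) (FinP.toℕ-injective (begin
        toℕ (Bijection.to (κ i j) (c j))   ≡⟨ extend-toℕ _ j ⟨
        κdigits i c (toℕ j)                ≡⟨ horner-injective D _ _ (prefix-digits c) (prefix-digits c') eq (toℕ j) j<D ⟩
        κdigits i c' (toℕ j)               ≡⟨ extend-toℕ _ j ⟩
        toℕ (Bijection.to (κ i j) (c' j))  ∎)))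
    (λ agree → horner-cong D (extend-cong-below D D≤m (λ j j<D → ≡.cong toℕ (Bijection.cong (κ i j) (agree j j<D)))))
    where
    open ≡.≡-Reasoning
    prefix-digits : ∀ c → Digits D (κdigits i c)
    prefix-digits c j j<D = κdigits-digits i c j (ℕP.<-≤-trans j<D D≤m)

  x≡horner : ∀ i n → x i n ≡ horner m (κdigits i (y i n)) /q^ m
  x≡horner i n = ≡.trans (QAdic.sumℚ-cong F {m} (λ j → ≡.cong (_/q^ suc (toℕ j)) (≡.sym (extend-toℕ _ j))))
                         (radix-sum m (κdigits i (y i n)) 0)

  count≡Σ< : ∀ d a → count d a ≡ Σ< (q ^ m) (λ n → ind (InJ? d a n))
  count≡Σ< d a = length-filter (InJ? d a) (λ n → n) (q ^ m)

  prefixMask : (Fin s → ℕ) → Mask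
  prefixMask d i j = toℕ j <ᵇ d i

  prefixMask⇔ : ∀ d i j → T (prefixMask d i j) ⇔ (toℕ j < d i)
  prefixMask⇔ d i j = mk⇔ (ℕP.<ᵇ⇒< (toℕ j) (d i)) ℕP.<⇒<ᵇ

  active-prefixMask : ∀ d → (∀ i → d i ≤ m) → active (prefixMask d) ≡ sumℕ d
  active-prefixMask d d≤m = NatSums.sum-cong-≗ {s} (λ i → count-row m (d i) (d≤m i))
    where
    count-row : ∀ m' D → D ≤ m' → sumℕ {m'} (λ j → if (toℕ j <ᵇ D) then 1 else 0) ≡ D
    count-row zero      zero    _       = ≡.refl
    count-row (suc m')  zero    _       = ≡.trans (NatSums.sum-const m' 0) (ℕP.*-zeroʳ m')
    count-row (suc m')  (suc D) (ℕ.s≤s D≤m') = ≡.cong suc (count-row m' D D≤m')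

  module Box (d : Fin s → ℕ) (d≤m : ∀ i → d i ≤ m) where

    -- The interval index a_i of the points whose i-th coordinate begins
    -- with the digits of the target block t i.
    index : Space s m → Fin s → ℕ
    index t i = horner (d i) (κdigits i (t i))

    index-bound : ∀ t i → index t i < q ^ d i
    index-bound t i = horner-bound (d i) _ (λ j j<d → κdigits-digits i (t i) j (ℕP.<-≤-trans j<d (d≤m i)))

    Matches : Space s m → ℕ → Set
    Matches t n = ∀ i j → toℕ j < d i → y i n j ≈ t i j

    inJ⇔matches : ∀ a t → (∀ i → a i ≡ index t i) → ∀ n → InJ d a n ⇔ Matches t n
    inJ⇔matches a t a≡ n = mk⇔
      (λ inJ i → to (same-prefix⇔ i (d i) (d≤m i) (y i n) (t i)) (≡.trans (to (coordinate i) (inJ i)) (a≡ i)))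
      (λ match i → from (coordinate i) (≡.trans (from (same-prefix⇔ i (d i) (d≤m i) (y i n) (t i)) (match i)) (≡.sym (a≡ i))))
      where
      coordinate : ∀ i → ((a i /q^ d i ℚ.≤ x i n) × (x i n ℚ.< suc (a i) /q^ d i)) ⇔ (horner (d i) (κdigits i (y i n)) ≡ a i)
      coordinate i = ≡.subst (λ w → ((a i /q^ d i ℚ.≤ w) × (w ℚ.< suc (a i) /q^ d i)) ⇔ (horner (d i) (κdigits i (y i n)) ≡ a i)) (≡.sym (x≡horner i n))
                       (inBlock⇔prefix m (d i) (κdigits i (y i n)) (a i) (d≤m i) (κdigits-digits i (y i n)))

    matches⇔solves : ∀ t n → Matches t n ⇔ Solves (prefixMask d) Cs t (digitVector η n)
    matches⇔solves t n = mk⇔ (λ match i j imposed → match i j (to (prefixMask⇔ d i j) imposed))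
                             (λ sol i j j<d → sol i j (from (prefixMask⇔ d i j) j<d))

    target : (a : Fin s → ℕ) → (∀ i → a i < q ^ d i) → Σ (Space s m) λ t → ∀ i → a i ≡ index t i
    target a a< = t , λ i → ≡.sym (≡.trans (horner-cong (d i) (κdigits-t i)) (horner-digitOf (d i) (a i) (a< i)))
      where
      digit-of-a : ∀ i (j : Fin m) → Fin q
      digit-of-a i j = fromℕ< (m%n<n (digitOf (d i) (a i) (toℕ j)) q)
      t : Space s m
      t i j = proj₁ (Bijection.surjective (κ i j) (digit-of-a i j))
      κdigits-t : ∀ i j' → j' < d i → κdigits i (t i) j' ≡ digitOf (d i) (a i) j'
      κdigits-t i j' j'<d = begin
          κdigits i (t i) j'
            ≡⟨ extend-cong-below (d i) {g = λ j → digitOf (d i) (a i) (toℕ j)} (d≤m i) (λ j j<d → begin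
                 toℕ (Bijection.to (κ i j) (t i j))         ≡⟨ ≡.cong toℕ (proj₂ (Bijection.surjective (κ i j) (digit-of-a i j)) refl) ⟩
                 toℕ (digit-of-a i j)                       ≡⟨ FinP.toℕ-fromℕ< _ ⟩
                 digitOf (d i) (a i) (toℕ j) % q            ≡⟨ m<n⇒m%n≡m (digitOf-digits (d i) (a i) (a< i) (toℕ j) j<d) ⟩
                 digitOf (d i) (a i) (toℕ j)                ∎) j' j'<d ⟩
          extend (λ j → digitOf (d i) (a i) (toℕ j)) j'
            ≡⟨ extend-digitOf j' (ℕP.<-≤-trans j'<d (d≤m i)) ⟩
          digitOf (d i) (a i) j' ∎
        where
        open ≡.≡-Reasoning
        extend-digitOf : ∀ j' → j' < m → extend (λ j → digitOf (d i) (a i) (toℕ j)) j' ≡ digitOf (d i) (a i) j'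
        extend-digitOf j' j'<m with j' <? m
        ... | yes p  = ≡.cong (digitOf (d i) (a i)) (FinP.toℕ-fromℕ< p)
        ... | no j'≮m = ⊥-elim (j'≮m j'<m)

    count≡solutions : ∀ a t → (∀ i → a i ≡ index t i) →
                      count d a ≡ Σvec η (λ c → ind (solves? (prefixMask d) Cs t c))
    count≡solutions a t a≡ = begin
        count d a
          ≡⟨ count≡Σ< d a ⟩
        Σ< (q ^ m) (λ n → ind (InJ? d a n))
          ≡⟨ Σ<-cong (q ^ m) (λ n _ → ind-iff (InJ? d a n) (solves? (prefixMask d) Cs t (digitVector η n))
                                               (to (equiv n)) (from (equiv n))) ⟩
        Σ< (q ^ m) (λ n → ind (solves? (prefixMask d) Cs t (digitVector η n)))
          ≡⟨ Σ<-digitVector m η _ solves-extensional ⟩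
        Σvec η (λ c → ind (solves? (prefixMask d) Cs t c)) ∎
      where
      open ≡.≡-Reasoning
      equiv : ∀ n → InJ d a n ⇔ Solves (prefixMask d) Cs t (digitVector η n)
      equiv n = mk⇔ (to (matches⇔solves t n) ∘ to (inJ⇔matches a t a≡ n))
                    (from (inJ⇔matches a t a≡ n) ∘ from (matches⇔solves t n))
      solves-extensional : DigitEnumeration.Extensional F (λ c → ind (solves? (prefixMask d) Cs t c))
      solves-extensional c c' eq = ind-iff (solves? _ Cs t c) (solves? _ Cs t c')
        (λ h i j imposed → trans (FieldSums.sum-cong-≋ F {m} (λ r → *-congˡ (reflexive (≡.sym (eq r))))) (h i j imposed))
        (λ h i j imposed → trans (FieldSums.sum-cong-≋ F {m} (λ r → *-congˡ (reflexive (eq r)))) (h i j imposed))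

    count-independent : Independent (prefixMask d) Cs → ∀ a → (∀ i → a i < q ^ d i) → count d a ℕ.* q ^ sumℕ d ≡ q ^ m
    count-independent indep a a< = begin
        count d a ℕ.* q ^ sumℕ d                 ≡⟨ ≡.cong (ℕ._* q ^ sumℕ d) (count≡solutions a t a≡) ⟩
        solutions ℕ.* q ^ sumℕ d                 ≡⟨ ≡.cong (λ k → solutions ℕ.* q ^ k) (active-prefixMask d d≤m) ⟨
        solutions ℕ.* q ^ active (prefixMask d)  ≡⟨ solution-count m η (prefixMask d) Cs indep t ⟩
        q ^ m                                    ∎
      where
      open ≡.≡-Reasoning
      t : Space s m
      t = proj₁ (target a a<)
      a≡ : ∀ i → a i ≡ index t i
      a≡ = proj₂ (target a a<)
      solutions : ℕ
      solutions = Σvec η (λ c → ind (solves? (prefixMask d) Cs t c))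

    -- A nonzero A ⊥ C supported on the first d i entries of each block
    -- exhibits an empty interval: the one matching the target single i₀ j₀.
    empty-interval : ∀ (A : Space s m) → Orthogonal A → (∀ i j → d i ≤ toℕ j → A i j ≈ 0#) →
                     ∀ i₀ j₀ → ¬ (A i₀ j₀ ≈ 0#) → Σ (Fin s → ℕ) λ a → (∀ i → a i < q ^ d i) × count d a ≡ 0
    empty-interval A A⊥ supported i₀ j₀ A₀≉0 =
      index t , index-bound t , ≡.trans (count≡Σ< d (index t))
        (≡.trans (Σ<-cong (q ^ m) (λ n _ → ind-no (InJ? d (index t) n) (A₀≉0 ∘ A₀≈0 n))) (Σ<-zero (q ^ m)))
      where
      t : Space s m
      t = single i₀ j₀
      term : ∀ n → Matches t n → ∀ i j → t i j * A i j ≈ A i j * y i n j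
      term n match i j with toℕ j <? d i
      ... | yes j<d = trans (*-comm _ _) (*-congˡ (sym (match i j j<d)))
      ... | no  j≮d = trans (trans (*-congˡ A≈0) (zeroʳ _)) (sym (trans (*-congʳ A≈0) (zeroˡ _)))
        where A≈0 = supported i j (ℕP.≮⇒≥ j≮d)
      A₀≈0 : ∀ n → InJ d (index t) n → A i₀ j₀ ≈ 0#
      A₀≈0 n inJ = begin
          A i₀ j₀                          ≈⟨ sym (Σ2-single i₀ j₀ A) ⟩
          Σ2 (λ i j → t i j * A i j)       ≈⟨ Σ2-cong (term n (to (inJ⇔matches (index t) t (λ _ → ≡.refl) n) inJ)) ⟩
          Σ2 (λ i j → A i j * y i n j)     ≈⟨ orthogonal⇒dual A A⊥ (λ i j → y i n j) (digitVector η n , λ i j → FieldSums.sum-cong-≋ F {m} (λ r → *-comm _ _)) ⟩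
          0#                               ∎
        where open import Relation.Binary.Reasoning.Setoid setoid

  NoDualSupportedOn : (Fin s → ℕ) → Set
  NoDualSupportedOn d = ∀ A → Orthogonal A → (∀ i j → d i ≤ toℕ j → A i j ≈ 0#) → IsZero A

  net⇔noDual : ∀ u e → IsDigitalNet u e Cs η κ ⇔
               (∀ d → (∀ i → e i ∣ d i) → u ℕ.+ sumℕ d ≤ m → NoDualSupportedOn d)
  net⇔noDual u e = mk⇔ net⇒noDual noDual⇒net
    where
    volume≥⇔ : ∀ d → ((q ^ u) /q^ m ℚ.≤ vol d) ⇔ (u ℕ.+ sumℕ d ≤ m)
    volume≥⇔ d = ≡.subst (λ w → ((q ^ u) /q^ m ℚ.≤ w) ⇔ (u ℕ.+ sumℕ d ≤ m)) (≡.sym (volume d))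
                         (volume-bound⇔ 1<q u m (sumℕ d))

    count≡⇔ : ∀ d a → ((+ count d a) ℚ./ 1 ≡ ((+ (q ^ m)) ℚ./ 1) ℚ.* vol d) ⇔ (count d a ℕ.* q ^ sumℕ d ≡ q ^ m)
    count≡⇔ d a = ≡.subst (λ w → ((+ count d a) ℚ./ 1 ≡ ((+ (q ^ m)) ℚ./ 1) ℚ.* w) ⇔ (count d a ℕ.* q ^ sumℕ d ≡ q ^ m))
                          (≡.sym (volume d)) (count-equation⇔ (count d a) m (sumℕ d))

    d≤m : ∀ d → u ℕ.+ sumℕ d ≤ m → ∀ i → d i ≤ m
    d≤m d le i = ℕP.≤-trans (sum-≥ d i) (ℕP.≤-trans (ℕP.m≤n+m _ u) le)

    net⇒noDual : IsDigitalNet u e Cs η κ → ∀ d → (∀ i → e i ∣ d i) → u ℕ.+ sumℕ d ≤ m → NoDualSupportedOn d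
    -- A nonzero entry of A would exhibit an empty interval of volume ≥ q^(u-m).
    net⇒noDual net d e∣d le A A⊥ supported i₀ j₀ = decidable-stable (A i₀ j₀ ≈? 0#) λ A₀≉0 →
      let (a , a< , empty) = Box.empty-interval d (d≤m d le) A A⊥ supported i₀ j₀ A₀≉0
          q^m≡0 : q ^ m ≡ 0
          q^m≡0 = ≡.trans (≡.sym (to (count≡⇔ d a) (net d a a< e∣d (from (volume≥⇔ d) le))))
                          (≡.cong (ℕ._* q ^ sumℕ d) empty)
      in ℕ.≢-nonZero⁻¹ (q ^ m) {{ℕP.m^n≢0 q m}} q^m≡0

    noDual⇒net : (∀ d → (∀ i → e i ∣ d i) → u ℕ.+ sumℕ d ≤ m → NoDualSupportedOn d) → IsDigitalNet u e Cs η κ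
    noDual⇒net noDual d a a< e∣d vol≥ =
      from (count≡⇔ d a) (Box.count-independent d (d≤m d le) independent a a<)
      where
      le : u ℕ.+ sumℕ d ≤ m
      le = to (volume≥⇔ d) vol≥
      independent : Independent (prefixMask d) Cs
      independent l off orthogonal = noDual d e∣d le l orthogonal
        (λ i j d≤j → off i j (λ imposed → ℕP.<⇒≱ (to (prefixMask⇔ d i j) imposed) d≤j))

module Distance {q : ℕ} (F : FiniteField q) (1<q : 1 < q) {s m : ℕ} (Cs : Fin s → Theory.Mat F m)
                (η : Fin m → Bijection (PE.setoid (Fin q)) (FiniteField.setoid F))
                (κ : Fin s → Fin m → Bijection (FiniteField.setoid F) (PE.setoid (Fin q)))
                (u : ℕ) (u≤m : u ≤ m) (1≤s : 1 ≤ s) (1≤m : 1 ≤ m)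
                (e : Fin s → ℕ) (enz : ∀ i → NonZero (e i)) where

  open FiniteField F hiding (zero)
  open Theory F hiding (sumℕ)
  open DigitalNets F 1<q Cs η κ using (net⇔noDual)
  open DualSpace F Cs using (dual⇒orthogonal; orthogonal⇒dual; dual?; dual-resp; nonsingular-block)
  open Support F using (vanish-beyond-lastNZ; lastNZ-least; v≡weight; IsZero?)
  open MinimumDistance F using (δ≥-intro; δ≥-elim)
  open Weight using (weight; weight-pos; weight<m; weight-least)
  open NatSums using (sum-≥; sum-mono; sum-others-zero) renaming (sum to sumℕ)
  open import Data.Nat as ℕ using (zero; suc; _≤_; _∸_; z≤n)
  import Data.Nat.Properties as ℕP
  open import Data.Nat.Divisibility using (_∣_)
  open import Data.Fin using (toℕ)
  import Data.Fin.Properties as FinP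
  open import Data.Product using (_×_; _,_; proj₁; proj₂)
  open import Data.Empty using (⊥; ⊥-elim)
  open import Relation.Nullary using (¬_; Dec; yes; no)
  open import Relation.Nullary.Decidable using (decidable-stable)
  open import Relation.Binary.PropositionalEquality as ≡ using (_≡_; _≢_)
  open import Function.Bundles using (Equivalence)
  open Equivalence using (to; from)

  C⊥ : Space s m → Set
  C⊥ = Dual (RowSpace Cs)

  vᵢ : Space s m → Fin s → ℕ
  vᵢ A i = v (e i) {{enz i}} (A i)

  V≤sum : ∀ d (A : Space s m) → (∀ i → e i ∣ d i) → (∀ i j → d i ≤ toℕ j → A i j ≈ 0#) → V e enz A ≤ sumℕ d
  V≤sum d A e∣d supported = sum-mono (vᵢ A) d λ i →
    ℕP.≤-trans (ℕP.≤-reflexive (v≡weight (e i) {{enz i}} (A i)))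
               (weight-least (e i) {{enz i}} m _ (d i) (e∣d i) (lastNZ-least (A i) (d i) (supported i)))

  supported-on-weights : ∀ (A : Space s m) → (∀ i → vᵢ A i < m) →
                         (∀ i → e i ∣ vᵢ A i) × (∀ i j → vᵢ A i ≤ toℕ j → A i j ≈ 0#)
  supported-on-weights A v<m =
      (λ i → let (e∣w , _) = below i in ≡.subst (e i ∣_) (≡.sym (eq i)) e∣w)
    , (λ i j vᵢ≤j → let (_ , L≤w) = below i in
         vanish-beyond-lastNZ (A i) j (ℕP.≤-trans L≤w (≡.subst (_≤ toℕ j) (eq i) vᵢ≤j)))
    where
    eq : ∀ i → vᵢ A i ≡ weight (e i) {{enz i}} m (lastNZ (A i))
    eq i = v≡weight (e i) {{enz i}} (A i)
    below : ∀ i → e i ∣ weight (e i) {{enz i}} m (lastNZ (A i)) × lastNZ (A i) ≤ weight (e i) {{enz i}} m (lastNZ (A i))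
    below i = weight<m (e i) {{enz i}} m (lastNZ (A i)) (≡.subst (_< m) (eq i) (v<m i))

  vᵢ≡0⇒zero : ∀ (A : Space s m) i → vᵢ A i ≡ 0 → ∀ j → A i j ≈ 0#
  vᵢ≡0⇒zero A i v≡0 j = vanish-beyond-lastNZ (A i) j (≡.subst (_≤ toℕ j) (≡.sym (lastNZ≡0 (lastNZ (A i)) ≡.refl)) z≤n)
    where
    lastNZ≡0 : ∀ L → lastNZ (A i) ≡ L → L ≡ 0
    lastNZ≡0 zero    _  = ≡.refl
    lastNZ≡0 (suc k) eq = ⊥-elim (ℕP.<⇒≢ (weight-pos (e i) {{enz i}} m k 1≤m) (≡.sym (begin
        weight (e i) {{enz i}} m (suc k)         ≡⟨ ≡.cong (weight (e i) {{enz i}} m) eq ⟨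
        weight (e i) {{enz i}} m (lastNZ (A i))  ≡⟨ v≡weight (e i) {{enz i}} (A i) ⟨
        vᵢ A i                                   ≡⟨ v≡0 ⟩
        0                                        ∎)))
      where open ≡.≡-Reasoning

  -- δ ≥ m - u + 1 makes every admissible d free of dual vectors: such a
  -- vector would have weight ≤ Σ d ≤ m - u.
  δ⇒net : δ≥ e enz C⊥ (m ∸ u ℕ.+ 1) → IsDigitalNet u e Cs η κ
  δ⇒net δ≥ = from (net⇔noDual u e) λ d e∣d le A A⊥ supported i j →
    decidable-stable (IsZero? A) (λ A≉0 → ℕP.<⇒≱ (begin-strict
        V e enz A      ≤⟨ V≤sum d A e∣d supported ⟩
        sumℕ d         ≤⟨ ℕP.m+n≤o⇒m≤o∸n (sumℕ d) (ℕP.≤-trans (ℕP.≤-reflexive (ℕP.+-comm (sumℕ d) u)) le) ⟩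
        m ∸ u          <⟨ ℕP.≤-reflexive (ℕP.+-comm 1 (m ∸ u)) ⟩
        m ∸ u ℕ.+ 1    ∎)
      (δ≥-elim e enz C⊥ _ δ≥ A (orthogonal⇒dual A A⊥) A≉0)) i j
    where open ℕP.≤-Reasoning

  -- In a net, a nonzero dual vector with all blocks of weight below m has
  -- weight above m - u: its weights form an admissible d.
  light-dual-vector : IsDigitalNet u e Cs η κ → ∀ A → C⊥ A → ¬ IsZero A → (∀ i → vᵢ A i < m) → ¬ (V e enz A ≤ m ∸ u)
  light-dual-vector net A A⊥ A≉0 v<m V≤ =
    let (e∣v , supported) = supported-on-weights A v<m
        u+V≤m = ℕP.≤-trans (ℕP.+-monoʳ-≤ u V≤) (ℕP.≤-reflexive (ℕP.m+[n∸m]≡n u≤m))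
    in A≉0 (to (net⇔noDual u e) net (vᵢ A) e∣v u+V≤m A (dual⇒orthogonal A A⊥) supported)

  -- With s ≥ 1 blocks, m ≤ sm, so the bounds m - u (+ 1) lie below sm + 1.
  m≤sm : m ≤ s ℕ.* m
  m≤sm = ℕP.≤-trans (ℕP.≤-reflexive (≡.sym (ℕP.*-identityˡ m))) (ℕP.*-monoˡ-≤ m 1≤s)

  net⇒δ : IsDigitalNet u e Cs η κ → δ≥ e enz C⊥ (m ∸ u)
  net⇒δ net = δ≥-intro e enz C⊥ dual? dual-resp (m ∸ u) (ℕP.≤-trans (ℕP.m∸n≤m m u) (ℕP.≤-trans m≤sm (ℕP.m≤m+n _ 1)))
    λ A A⊥ A≉0 → ℕP.≮⇒≥ λ V<m-u →
      light-dual-vector net A A⊥ A≉0 (λ i → ℕP.≤-<-trans (sum-≥ (vᵢ A) i) (ℕP.<-≤-trans V<m-u (ℕP.m∸n≤m m u))) (ℕP.<⇒≤ V<m-u)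

  -- Part (a): with nonsingular C_i, a net even has δ ≥ m - u + 1.  A dual
  -- vector of weight ≤ m - u with some block of weight ≥ m has all other
  -- blocks zero, and then its remaining block is zero by nonsingularity.
  net⇒δ-nonsingular : (∀ i → Nonsingular (Cs i)) → IsDigitalNet u e Cs η κ → δ≥ e enz C⊥ (m ∸ u ℕ.+ 1)
  net⇒δ-nonsingular ns net = δ≥-intro e enz C⊥ dual? dual-resp (m ∸ u ℕ.+ 1) (ℕP.+-monoˡ-≤ 1 (ℕP.≤-trans (ℕP.m∸n≤m m u) m≤sm))
    λ A A⊥ A≉0 → ℕP.≮⇒≥ λ V<m-u+1 →
      heavy-block A A⊥ A≉0 (ℕP.m<1+n⇒m≤n (≡.subst (V e enz A <_) (ℕP.+-comm (m ∸ u) 1) V<m-u+1))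
                  (FinP.all? (λ i → vᵢ A i ℕP.<? m))
    where
    heavy-block : ∀ A → C⊥ A → ¬ IsZero A → V e enz A ≤ m ∸ u → Dec (∀ i → vᵢ A i < m) → ⊥
    heavy-block A A⊥ A≉0 V≤ (yes v<m) = light-dual-vector net A A⊥ A≉0 v<m V≤
    heavy-block A A⊥ A≉0 V≤ (no ¬v<m) = A≉0 λ i j → by-block i j (i FinP.≟ i₀)
      where
      i₀ : Fin s
      i₀ = proj₁ (FinP.¬∀⟶∃¬ s _ (λ i → vᵢ A i ℕP.<? m) ¬v<m)
      m≤v₀ : m ≤ vᵢ A i₀
      m≤v₀ = ℕP.≮⇒≥ (proj₂ (FinP.¬∀⟶∃¬ s _ (λ i → vᵢ A i ℕP.<? m) ¬v<m))
      others-zero : ∀ i → i ≢ i₀ → ∀ j → A i j ≈ 0#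
      others-zero i i≢i₀ = vᵢ≡0⇒zero A i (sum-others-zero (vᵢ A) i₀ m (ℕP.≤-trans V≤ (ℕP.m∸n≤m m u)) m≤v₀ i i≢i₀)
      by-block : ∀ i j → Dec (i ≡ i₀) → A i j ≈ 0#
      by-block i j (yes ≡.refl) = nonsingular-block A i₀ (ns i₀) (dual⇒orthogonal A A⊥) others-zero j
      by-block i j (no i≢i₀)    = others-zero i i≢i₀ j

open import Data.Nat using (_≤_; _∸_; _+_)
open import Data.Product using (_×_)
open import Function.Bundles using (_⇔_)
open import Relation.Binary.PropositionalEquality using (setoid)

open import Data.Nat using (suc; _^_; nonTrivial⇒n>1)
import Data.Nat.Properties as ℕP
open import Data.Nat.Primality using (prime⇒nonZero; prime⇒nonTrivial)
open import Data.Product using (_,_)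
open import Function.Bundles using (mk⇔)

prime-power>1 : ∀ {q} → IsPrimePower q → 1 < q
prime-power>1 (p , suc k , p-prime , _ , PE.refl) =
  ℕP.<-≤-trans (nonTrivial⇒n>1 p {{prime⇒nonTrivial p-prime}})
               (ℕP.m≤m*n p (p ^ k) {{ℕP.m^n≢0 p k {{prime⇒nonZero p-prime}}}})

theorem7 : ∀ {q : ℕ} (F : FiniteField q) → IsPrimePower q
    → (s m u : ℕ) → 1 ≤ s → 1 ≤ m → u ≤ m
    → (e : Fin s → ℕ) (enz : ∀ i → NonZero (e i))
    → (Cs : Fin s → Theory.Mat F m)
    → (η : Fin m → Bijection (setoid (Fin q)) (FiniteField.setoid F))
    → (κ : Fin s → Fin m → Bijection (FiniteField.setoid F) (setoid (Fin q)))
    → ((∀ i → Theory.Nonsingular F (Cs i))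
        → (Theory.IsDigitalNet F u e Cs η κ
           ⇔ Theory.δ≥ F e enz (Theory.Dual F (Theory.RowSpace F Cs)) (m ∸ u + 1)))
      × (Theory.δ≥ F e enz (Theory.Dual F (Theory.RowSpace F Cs)) (m ∸ u + 1)
          → Theory.IsDigitalNet F u e Cs η κ)
      × (Theory.IsDigitalNet F u e Cs η κ
          → Theory.δ≥ F e enz (Theory.Dual F (Theory.RowSpace F Cs)) (m ∸ u))
theorem7 F prime-power s m u 1≤s 1≤m u≤m e enz Cs η κ =
    (λ nonsingular → mk⇔ (net⇒δ-nonsingular nonsingular) δ⇒net)
  , δ⇒net
  , net⇒δ
  where open Distance F (prime-power>1 prime-power) Cs η κ u u≤m 1≤s 1≤m e enz
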